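{- Let $R$ be a commutative $\mathbb{Q}$-algebra with unit. Then $(R\langle\langle \mathcal{B}\rangle\rangle,\operatorname{conc},\Delta_b)$ is a complete, cocommutative Hopf algebra. Moreover, the pairing \[R\langle\langle \mathcal{B}\rangle\rangle\otimes \mathbb{Q}\langle \mathcal{B}\rangle\to R,\qquad \Phi\otimes w\mapsto (\Phi\mid w),\] where $(\Phi\mid w)$ denotes the coefficient of the word $w$ in $\Phi$, gives a duality between the weight-graded Hopf algebra $(\mathbb{Q}\langle \mathcal{B}\rangle,\ast_b,\Delta_{\operatorname{dec}})$ and the complete Hopf algebra $(R\langle\langle \mathcal{B}\rangle\rangle,\operatorname{conc},\Delta_b)$; i.e. $\operatorname{conc}$ is dual to $\Delta_{\operatorname{dec}}$ and $\Delta_b$ is dual to $\ast_b$ (for all $\Phi$ and words $u,v$: $(\Delta_b(\Phi)\mid u\otimes v)=(\Phi\mid u\ast_b v)$).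
   Context: Let $\mathcal{B}=\{b_0,b_1,b_2,\ldots\}$ be an alphabet, $\mathcal{B}^*$ the set of words (empty word $\mathbf{1}$), $\mathbb{Q}\langle\mathcal{B}\rangle$ the free non-commutative polynomial algebra and $R\langle\langle\mathcal{B}\rangle\rangle$ the algebra of non-commutative power series in $\mathcal{B}$ with coefficients in $R$, with concatenation product $\operatorname{conc}$. The weight of a word $b_{s_1}\cdots b_{s_l}$ is $s_1+\dots+s_l+\#\{i: s_i=0\}$. The balanced quasi-shuffle product $\ast_b$ on $\mathbb{Q}\langle\mathcal{B}\rangle$ is defined recursively by $\mathbf{1}\ast_b w=w\ast_b\mathbf{1}=w$ and $b_iu\ast_b b_jv=b_i(u\ast_b b_jv)+b_j(b_iu\ast_b v)+\delta\, b_{i+j}(u\ast_b v)$, where $\delta=1$ if $i,j\geq1$ and $\delta=0$ otherwise, for all words $u,v,w$. $\Delta_{\operatorname{dec}}(w)=\sum_{uv=w}u\otimes v$ is the deconcatenation coproduct. The coproduct $\Delta_b$ on $R\langle\langle\mathcal{B}\rangle\rangle$ is the (continuous) algebra morphism for concatenation determined by $\Delta_b(b_i)=\mathbf{1}\otimes b_i+b_i\otimes\mathbf{1}+\sum_{j=1}^{i-1}b_j\otimes b_{i-j}$ for $i\geq0$. -}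

module Defs where

open import Level using (_⊔_)
open import Data.Nat using (ℕ; zero; suc; _∸_) renaming (_+_ to _+ℕ_)
import Data.Nat.Properties as ℕP
open import Data.List using (List; []; _∷_; map; _++_; concatMap; upTo; filter; foldr)
import Data.List.Properties as LP
open import Data.List.Relation.Unary.All using (All)
open import Data.Product using (_×_; _,_; ∃; Σ)
open import Relation.Nullary using (Dec; yes; no)
open import Relation.Binary.PropositionalEquality using (_≡_)
open import Algebra.Bundles using (CommutativeRing)

-- Alphabet B = {b_0, b_1, ...}: the letter b_i is the natural number i.
-- Words B* are lists of letters; the empty word is [].

Word : Set
Word = List ℕ

_≟W_ : (u v : Word) → Dec (u ≡ v)
_≟W_ = LP.≡-dec ℕP._≟_

weight : Word → ℕ
weight []          = 0
weight (zero  ∷ w) = suc (weight w)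
weight (suc i ∷ w) = suc i +ℕ weight w

wordsOfLen : ℕ → ℕ → List Word
wordsOfLen n zero    = [] ∷ []
wordsOfLen n (suc k) = concatMap (λ a → map (a ∷_) (wordsOfLen n k)) (upTo (suc n))

-- all words of weight exactly n (each such word has length ≤ n and
-- letters ≤ n); a finite list without repetitions
wordsOfWeight : ℕ → List Word
wordsOfWeight n =
  filter (λ w → weight w ℕP.≟ n) (concatMap (wordsOfLen n) (upTo (suc n)))

splits : Word → List (Word × Word)
splits []      = ([] , []) ∷ []
splits (a ∷ w) = ([] , a ∷ w) ∷ map (λ { (x , y) → (a ∷ x , y) }) (splits w)

-- Balanced quasi-shuffle product, as a formal sum (list with
-- multiplicities) of words:
-- b_i u *b b_j v = b_i(u *b b_j v) + b_j(b_i u *b v) + δ b_{i+j}(u *b v)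

extraTerm : ℕ → ℕ → List Word → List Word
extraTerm (suc i) (suc j) l = map ((suc i +ℕ suc j) ∷_) l
extraTerm _       _       l = []

qsh : Word → Word → List Word
qsh []      v       = v ∷ []
qsh (a ∷ u) []      = (a ∷ u) ∷ []
qsh (i ∷ u) (j ∷ v) =
  map (i ∷_) (qsh u (j ∷ v)) ++ map (j ∷_) (qsh (i ∷ u) v) ++ extraTerm i j (qsh u v)

-- The coproduct Δ_b on words, as a formal sum of tensors u ⊗ v.
-- Δ_b(b_i) = 1⊗b_i + b_i⊗1 + Σ_{j=1}^{i-1} b_j ⊗ b_{i-j}

ΔLetter : ℕ → List (Word × Word)
ΔLetter i = ([] , i ∷ []) ∷ (i ∷ [] , []) ∷
            map (λ j → (j ∷ [] , (i ∸ j) ∷ [])) (map suc (upTo (i ∸ 1)))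

mulT : List (Word × Word) → List (Word × Word) → List (Word × Word)
mulT xs ys = concatMap (λ { (a , b) → map (λ { (c , d) → (a ++ c , b ++ d) }) ys }) xs

-- Δ_b is a concatenation morphism: Δ_b(b_{i1}...b_{il}) = Δ_b(b_{i1})...Δ_b(b_{il})
ΔWord : Word → List (Word × Word)
ΔWord []      = ([] , []) ∷ []
ΔWord (i ∷ w) = mulT (ΔLetter i) (ΔWord w)

module Series {c ℓ} (R : CommutativeRing c ℓ) where
  open CommutativeRing R

  natR : ℕ → Carrier
  natR zero    = 0#
  natR (suc n) = 1# + natR n

  -- R is a Q-algebra (with unit): every positive integer is invertible
  IsQAlgebra : Set (c ⊔ ℓ)
  IsQAlgebra = (n : ℕ) → ∃ λ y → natR (suc n) * y ≈ 1#

  ΣL : {A : Set} → List A → (A → Carrier) → Carrier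
  ΣL xs f = foldr (λ x r → f x + r) 0# xs

  ind : {P : Set} → Dec P → Carrier
  ind (yes _) = 1#
  ind (no _)  = 0#

  -- R<<B>>  (all functions from words to R = the completion), and the
  -- completed tensor powers R<<B>> ⊗^ R<<B>> etc.
  Ser : Set c
  Ser = Word → Carrier
  Ser2 : Set c
  Ser2 = Word → Word → Carrier
  Ser3 : Set c
  Ser3 = Word → Word → Word → Carrier

  ⟨_∣_⟩ : Ser → Word → Carrier
  ⟨ Φ ∣ w ⟩ = Φ w

  _≈S_ : Ser → Ser → Set ℓ
  Φ ≈S Ψ = ∀ w → Φ w ≈ Ψ w
  _≈S2_ : Ser2 → Ser2 → Set ℓ
  X ≈S2 Y = ∀ u v → X u v ≈ Y u v
  _≈S3_ : Ser3 → Ser3 → Set ℓ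
  X ≈S3 Y = ∀ u v w → X u v w ≈ Y u v w

  _+S_ : Ser → Ser → Ser
  (Φ +S Ψ) w = Φ w + Ψ w
  _·S_ : Carrier → Ser → Ser
  (r ·S Φ) w = r * Φ w

  oneS : Ser
  oneS []      = 1#
  oneS (_ ∷ _) = 0#

  conc : Ser → Ser → Ser
  conc Φ Ψ w = ΣL (splits w) (λ { (x , y) → Φ x * Ψ y })

  ε : Ser → Carrier
  ε Φ = Φ []

  ηε : Ser → Ser
  ηε Φ w = Φ [] * oneS w

  -- Δ_b extended continuously and linearly: Δ_b(Φ) = Σ_w Φ(w) Δ_b(w).
  -- Δ_b preserves weight, so the coefficient of u ⊗ v only receives
  -- contributions from the finitely many words of weight wt(u)+wt(v).
  Δb : Ser → Ser2
  Δb Φ u v = ΣL (wordsOfWeight (weight u +ℕ weight v)) λ w →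
               ΣL (ΔWord w) (λ { (x , y) → (ind (x ≟W u) * ind (y ≟W v)) * Φ w })

  conc2 : Ser2 → Ser2 → Ser2
  conc2 X Y u v = ΣL (splits u) λ { (u₁ , u₂) →
                    ΣL (splits v) λ { (v₁ , v₂) → X u₁ v₁ * Y u₂ v₂ } }
  one2 : Ser2
  one2 u v = oneS u * oneS v

  Δ⊗id : Ser2 → Ser3
  Δ⊗id X u v w = Δb (λ x → X x w) u v
  id⊗Δ : Ser2 → Ser3
  id⊗Δ X u v w = Δb (X u) v w

  mult : Ser2 → Ser
  mult X w = ΣL (splits w) (λ { (x , y) → X x y })

  S⊗id : (Ser → Ser) → Ser2 → Ser2
  S⊗id S X u v = S (λ x → X x v) u
  id⊗S : (Ser → Ser) → Ser2 → Ser2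
  id⊗S S X u v = S (X u) v

  record IsContinuousLinear (S : Ser → Ser) : Set (c ⊔ ℓ) where
    field
      resp       : ∀ Φ Ψ → Φ ≈S Ψ → S Φ ≈S S Ψ
      additive   : ∀ Φ Ψ → S (Φ +S Ψ) ≈S (S Φ +S S Ψ)
      homogen    : ∀ r Φ → S (r ·S Φ) ≈S (r ·S S Φ)
      -- each coefficient of S Φ depends only on finitely many coefficients of Φ
      continuous : ∀ u → ∃ λ (L : List Word) → ∀ Φ Ψ →
                     All (λ w → Φ w ≈ Ψ w) L → S Φ u ≈ S Ψ u

  record IsCompleteCocommutativeHopf : Set (c ⊔ ℓ) where
    field
      conc-assoc   : ∀ Φ Ψ Χ → conc (conc Φ Ψ) Χ ≈S conc Φ (conc Ψ Χ)
      conc-unitˡ   : ∀ Φ → conc oneS Φ ≈S Φ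
      conc-unitʳ   : ∀ Φ → conc Φ oneS ≈S Φ
      Δ-resp       : ∀ Φ Ψ → Φ ≈S Ψ → Δb Φ ≈S2 Δb Ψ
      Δ-additive   : ∀ Φ Ψ → Δb (Φ +S Ψ) ≈S2 (λ u v → Δb Φ u v + Δb Ψ u v)
      Δ-homogen    : ∀ r Φ → Δb (r ·S Φ) ≈S2 (λ u v → r * Δb Φ u v)
      coassoc      : ∀ Φ → Δ⊗id (Δb Φ) ≈S3 id⊗Δ (Δb Φ)
      counitˡ      : ∀ Φ → (λ v → Δb Φ [] v) ≈S Φ
      counitʳ      : ∀ Φ → (λ u → Δb Φ u []) ≈S Φ
      Δ-mult       : ∀ Φ Ψ → Δb (conc Φ Ψ) ≈S2 conc2 (Δb Φ) (Δb Ψ)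
      Δ-unit       : Δb oneS ≈S2 one2
      ε-mult       : ∀ Φ Ψ → ε (conc Φ Ψ) ≈ ε Φ * ε Ψ
      ε-unit       : ε oneS ≈ 1#
      cocomm       : ∀ Φ → Δb Φ ≈S2 (λ u v → Δb Φ v u)
      antipode     : ∃ λ (S : Ser → Ser) → IsContinuousLinear S ×
                       (∀ Φ → mult (S⊗id S (Δb Φ)) ≈S ηε Φ) ×
                       (∀ Φ → mult (id⊗S S (Δb Φ)) ≈S ηε Φ)

  record Duality : Set (c ⊔ ℓ) where
    field
      conc-dual : ∀ Φ Ψ w →
        ⟨ conc Φ Ψ ∣ w ⟩ ≈ ΣL (splits w) (λ { (u , v) → ⟨ Φ ∣ u ⟩ * ⟨ Ψ ∣ v ⟩ })
      Δ-dual    : ∀ Φ u v → Δb Φ u v ≈ ΣL (qsh u v) (λ w → ⟨ Φ ∣ w ⟩)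

{-# OPTIONS --safe #-}
module Submission where

-- Everything rests on one count: for all words u, v, w, the multiplicity of w in u ∗_b v equals
-- that of u ⊗ v in Δ_b(w). It is proved by induction on w; the middle terms Σ_j b_j ⊗ b_{i-j} of
-- Δ_b(b_i) match exactly the stuffed letters b_{a+b} of the quasi-shuffle. Since Δ_b preserves
-- weight, this identifies the coefficient of u ⊗ v in Δ_b Φ with the pairing ⟨ Φ ∣ u ∗_b v ⟩.
-- Through the pairing, coassociativity, cocommutativity and multiplicativity of Δ_b become
-- associativity and commutativity of ∗_b and its compatibility with deconcatenation, each proved
-- by expanding along first letters. The antipode is the convolution inverse of the identity: a
-- recursion on words builds a right inverse, and a left inverse built by recursion on proper
-- prefixes shows that it is two-sided.

open import Level using (_⊔_)
open import Function using (id)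
open import Algebra.Bundles using (Semiring; CommutativeRing)
open import Data.Product using (_×_; _,_; proj₁; proj₂)
open import Data.Sum using (_⊎_; inj₁; inj₂)
open import Data.Empty using (⊥-elim)
open import Data.List using (List; []; _∷_; map; _++_; concatMap; foldr; upTo; filter; length)
import Data.List.Properties as LP
open import Data.List.Relation.Unary.All as All using (All; []; _∷_)
import Data.List.Relation.Unary.All.Properties as AllP
import Data.Nat.Properties as ℕP
open import Relation.Nullary using (Dec; yes; no; ¬_)
import Relation.Binary.PropositionalEquality as ≡
open import Defs

module ListSum {c ℓ} (S : Semiring c ℓ) where
  open Semiring S
  open import Algebra.Properties.CommutativeSemigroup +-commutativeSemigroup using (interchange)

  ∑ : {A : Set} → List A → (A → Carrier) → Carrier
  ∑ xs f = foldr (λ x r → f x + r) 0# xs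

  private variable A B : Set

  ∑-cong : ∀ (xs : List A) {f g} → (∀ x → f x ≈ g x) → ∑ xs f ≈ ∑ xs g
  ∑-cong []       f≈g = refl
  ∑-cong (x ∷ xs) f≈g = +-cong (f≈g x) (∑-cong xs f≈g)

  ∑-cong-All : ∀ {xs : List A} {f g} → All (λ x → f x ≈ g x) xs → ∑ xs f ≈ ∑ xs g
  ∑-cong-All []            = refl
  ∑-cong-All (fx≈gx ∷ all) = +-cong fx≈gx (∑-cong-All all)

  ∑-++ : ∀ (xs ys : List A) f → ∑ (xs ++ ys) f ≈ ∑ xs f + ∑ ys f
  ∑-++ []       ys f = sym (+-identityˡ _)
  ∑-++ (x ∷ xs) ys f = trans (+-congˡ (∑-++ xs ys f)) (sym (+-assoc _ _ _))

  ∑-map : ∀ (g : A → B) xs f → ∑ (map g xs) f ≈ ∑ xs (λ x → f (g x))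
  ∑-map g []       f = refl
  ∑-map g (x ∷ xs) f = +-congˡ (∑-map g xs f)

  ∑-concatMap : ∀ (g : A → List B) xs f → ∑ (concatMap g xs) f ≈ ∑ xs (λ x → ∑ (g x) f)
  ∑-concatMap g []       f = refl
  ∑-concatMap g (x ∷ xs) f = trans (∑-++ (g x) (concatMap g xs) f) (+-congˡ (∑-concatMap g xs f))

  ∑-0 : ∀ (xs : List A) → ∑ xs (λ _ → 0#) ≈ 0#
  ∑-0 []       = refl
  ∑-0 (x ∷ xs) = trans (+-congˡ (∑-0 xs)) (+-identityˡ 0#)

  ∑-+ : ∀ (xs : List A) f g → ∑ xs (λ x → f x + g x) ≈ ∑ xs f + ∑ xs g
  ∑-+ []       f g = sym (+-identityˡ 0#)
  ∑-+ (x ∷ xs) f g = trans (+-congˡ (∑-+ xs f g)) (interchange (f x) (g x) _ _)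

  ∑-*ˡ : ∀ (xs : List A) r f → ∑ xs (λ x → r * f x) ≈ r * ∑ xs f
  ∑-*ˡ []       r f = sym (zeroʳ r)
  ∑-*ˡ (x ∷ xs) r f = trans (+-congˡ (∑-*ˡ xs r f)) (sym (distribˡ r _ _))

  ∑-*ʳ : ∀ (xs : List A) r f → ∑ xs (λ x → f x * r) ≈ ∑ xs f * r
  ∑-*ʳ []       r f = sym (zeroˡ r)
  ∑-*ʳ (x ∷ xs) r f = trans (+-congˡ (∑-*ʳ xs r f)) (sym (distribʳ r _ _))

  ∑-swap : ∀ (xs : List A) (ys : List B) (f : A → B → Carrier) →
           ∑ xs (λ x → ∑ ys (f x)) ≈ ∑ ys (λ y → ∑ xs (λ x → f x y))
  ∑-swap []       ys f = sym (∑-0 ys)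
  ∑-swap (x ∷ xs) ys f = trans (+-congˡ (∑-swap xs ys f)) (sym (∑-+ ys (f x) _))

module Multiplicity where
  open import Data.Nat using (ℕ; zero; suc; _∸_; _+_; _*_; _<_; _≤_; z≤n; s≤s; _<?_; _≤?_)
  open ≡ using (_≡_; _≢_; refl; cong; cong₂; sym; trans; subst)
  open ≡.≡-Reasoning
  open ListSum ℕP.+-*-semiring
  open import Algebra.Properties.CommutativeSemigroup ℕP.*-commutativeSemigroup
    using () renaming (x∙yz≈y∙xz to *-leftComm)
  open import Algebra.Properties.CommutativeSemigroup ℕP.+-commutativeSemigroup
    using () renaming (x∙yz≈y∙xz to +-leftComm; interchange to +-interchange)

  indℕ : ∀ {p} {P : Set p} → Dec P → ℕ
  indℕ (yes _) = 1
  indℕ (no _)  = 0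

  indℕ-yes : ∀ {p} {P : Set p} (d : Dec P) → P → indℕ d ≡ 1
  indℕ-yes (yes _)  _ = refl
  indℕ-yes (no ¬p)  p = ⊥-elim (¬p p)

  indℕ-no : ∀ {p} {P : Set p} (d : Dec P) → ¬ P → indℕ d ≡ 0
  indℕ-no (yes p) ¬p = ⊥-elim (¬p p)
  indℕ-no (no _)  _  = refl

  indℕ-⇔ : ∀ {p q} {P : Set p} {Q : Set q} (d : Dec P) (e : Dec Q) →
           (P → Q) → (Q → P) → indℕ d ≡ indℕ e
  indℕ-⇔ (yes p) e P⇒Q Q⇒P = sym (indℕ-yes e (P⇒Q p))
  indℕ-⇔ (no ¬p) e P⇒Q Q⇒P = sym (indℕ-no e (λ q → ¬p (Q⇒P q)))

  eqℕ : ℕ → ℕ → ℕ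
  eqℕ a b = indℕ (a ℕP.≟ b)

  eqℕ-refl : ∀ a → eqℕ a a ≡ 1
  eqℕ-refl a = indℕ-yes (a ℕP.≟ a) refl

  eqℕ-≢ : ∀ {a b} → a ≢ b → eqℕ a b ≡ 0
  eqℕ-≢ {a} {b} = indℕ-no (a ℕP.≟ b)

  eqℕ-sym : ∀ a b → eqℕ a b ≡ eqℕ b a
  eqℕ-sym a b = indℕ-⇔ (a ℕP.≟ b) (b ℕP.≟ a) sym sym

  eqℕ-suc : ∀ a b → eqℕ (suc a) (suc b) ≡ eqℕ a b
  eqℕ-suc a b = indℕ-⇔ (suc a ℕP.≟ suc b) (a ℕP.≟ b) ℕP.suc-injective (cong suc)

  eqW : Word → Word → ℕ
  eqW []      []      = 1
  eqW []      (_ ∷ _) = 0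
  eqW (_ ∷ _) []      = 0
  eqW (a ∷ x) (b ∷ y) = eqℕ a b * eqW x y

  eqW-refl : ∀ x → eqW x x ≡ 1
  eqW-refl []      = refl
  eqW-refl (a ∷ x) rewrite eqℕ-refl a | eqW-refl x = refl

  eqW-≢ : ∀ {x y} → x ≢ y → eqW x y ≡ 0
  eqW-≢ {[]}    {[]}    x≢y = ⊥-elim (x≢y refl)
  eqW-≢ {[]}    {_ ∷ _} x≢y = refl
  eqW-≢ {_ ∷ _} {[]}    x≢y = refl
  eqW-≢ {a ∷ x} {b ∷ y} x≢y with a ℕP.≟ b
  ... | no _     = refl
  ... | yes refl = trans (ℕP.+-identityʳ (eqW x y)) (eqW-≢ (λ x≡y → x≢y (cong (a ∷_) x≡y)))

  eqW≡indℕ : ∀ x y → eqW x y ≡ indℕ (x ≟W y)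
  eqW≡indℕ x y with x ≟W y
  ... | yes refl = eqW-refl x
  ... | no x≢y   = eqW-≢ x≢y

  eqW-sym : ∀ x y → eqW x y ≡ eqW y x
  eqW-sym x y = trans (eqW≡indℕ x y) (trans (indℕ-⇔ (x ≟W y) (y ≟W x) sym sym) (sym (eqW≡indℕ y x)))

  eqW≡0⊎≡ : ∀ x y → eqW x y ≡ 0 ⊎ x ≡ y
  eqW≡0⊎≡ x y with x ≟W y
  ... | yes x≡y = inj₂ x≡y
  ... | no x≢y  = inj₁ (eqW-≢ x≢y)

  ∑-eqℕ-upTo : ∀ m a → ∑ (upTo m) (λ k → eqℕ k a) ≡ indℕ (a <? m)
  ∑-eqℕ-upTo zero    a = sym (indℕ-no (a <? 0) (λ ()))
  ∑-eqℕ-upTo (suc m) a = begin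
    ∑ (upTo (suc m)) (λ k → eqℕ k a)
      ≡⟨ cong (λ ks → ∑ (0 ∷ ks) (λ k → eqℕ k a)) (sym (LP.map-upTo suc m)) ⟩
    eqℕ 0 a + ∑ (map suc (upTo m)) (λ k → eqℕ k a)
      ≡⟨ cong (eqℕ 0 a +_) (∑-map suc (upTo m) (λ k → eqℕ k a)) ⟩
    eqℕ 0 a + ∑ (upTo m) (λ k → eqℕ (suc k) a)
      ≡⟨ split a ⟩
    indℕ (a <? suc m) ∎
    where
    split : ∀ a → eqℕ 0 a + ∑ (upTo m) (λ k → eqℕ (suc k) a) ≡ indℕ (a <? suc m)
    split zero     = cong suc (∑-0 (upTo m))
    split (suc a) = begin
      ∑ (upTo m) (λ k → eqℕ (suc k) (suc a)) ≡⟨ ∑-cong (upTo m) (λ k → eqℕ-suc k a) ⟩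
      ∑ (upTo m) (λ k → eqℕ k a)             ≡⟨ ∑-eqℕ-upTo m a ⟩
      indℕ (a <? m)                          ≡⟨ indℕ-⇔ (a <? m) (suc a <? suc m) s≤s ℕP.≤-pred ⟩
      indℕ (suc a <? suc m)                  ∎

  ∑-pick : ∀ xs a (f : ℕ → ℕ) → ∑ xs (λ j → eqℕ j a * f j) ≡ ∑ xs (λ j → eqℕ j a) * f a
  ∑-pick []       a f = refl
  ∑-pick (j ∷ xs) a f with j ℕP.≟ a
  ... | yes refl = cong₂ _+_ (ℕP.+-identityʳ (f j)) (∑-pick xs j f)
  ... | no _     = ∑-pick xs a f

  occ : Word → List Word → ℕ
  occ w L = ∑ L (λ x → eqW x w)

  occ-map-∷ : ∀ a i w L → occ (i ∷ w) (map (a ∷_) L) ≡ eqℕ a i * occ w L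
  occ-map-∷ a i w L = trans (∑-map (a ∷_) L _) (∑-*ˡ L (eqℕ a i) (λ x → eqW x w))

  occ-[]-map-∷ : ∀ a L → occ [] (map (a ∷_) L) ≡ 0
  occ-[]-map-∷ a L = trans (∑-map (a ∷_) L _) (∑-0 L)

  stuffing : ℕ → ℕ → ℕ → ℕ
  stuffing (suc a) (suc b) i = eqℕ (suc a + suc b) i
  stuffing _       _       _ = 0

  occ-extraTerm : ∀ a b i w L → occ (i ∷ w) (extraTerm a b L) ≡ stuffing a b i * occ w L
  occ-extraTerm zero    b       i w L = refl
  occ-extraTerm (suc a) zero    i w L = refl
  occ-extraTerm (suc a) (suc b) i w L = occ-map-∷ (suc a + suc b) i w L

  occ-[]-extraTerm : ∀ a b L → occ [] (extraTerm a b L) ≡ 0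
  occ-[]-extraTerm zero    b       L = refl
  occ-[]-extraTerm (suc a) zero    L = refl
  occ-[]-extraTerm (suc a) (suc b) L = occ-[]-map-∷ _ L

  occ² : Word → Word → List (Word × Word) → ℕ
  occ² u v P = ∑ P (λ p → eqW (proj₁ p) u * eqW (proj₂ p) v)

  whenPrefix : Word → Word → (Word → ℕ) → ℕ
  whenPrefix []      u       k = k u
  whenPrefix (_ ∷ _) []      k = 0
  whenPrefix (a ∷ p) (b ∷ u) k = eqℕ a b * whenPrefix p u k

  whenPrefix-cong : ∀ p u {k k′} → (∀ u′ → k u′ ≡ k′ u′) → whenPrefix p u k ≡ whenPrefix p u k′
  whenPrefix-cong []      u       k≡k′ = k≡k′ u
  whenPrefix-cong (a ∷ p) []      k≡k′ = refl
  whenPrefix-cong (a ∷ p) (b ∷ u) k≡k′ = cong (eqℕ a b *_) (whenPrefix-cong p u k≡k′)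

  whenPrefix-*ʳ : ∀ p u k n → whenPrefix p u k * n ≡ whenPrefix p u (λ u′ → k u′ * n)
  whenPrefix-*ʳ []      u       k n = refl
  whenPrefix-*ʳ (a ∷ p) []      k n = refl
  whenPrefix-*ʳ (a ∷ p) (b ∷ u) k n =
    trans (ℕP.*-assoc (eqℕ a b) _ n) (cong (eqℕ a b *_) (whenPrefix-*ʳ p u k n))

  whenPrefix-*ˡ : ∀ p u k n → n * whenPrefix p u k ≡ whenPrefix p u (λ u′ → n * k u′)
  whenPrefix-*ˡ []      u       k n = refl
  whenPrefix-*ˡ (a ∷ p) []      k n = ℕP.*-zeroʳ n
  whenPrefix-*ˡ (a ∷ p) (b ∷ u) k n =
    trans (*-leftComm n (eqℕ a b) _) (cong (eqℕ a b *_) (whenPrefix-*ˡ p u k n))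

  ∑-whenPrefix : ∀ {A : Set} (L : List A) p u (k : A → Word → ℕ) →
                 ∑ L (λ x → whenPrefix p u (k x)) ≡ whenPrefix p u (λ u′ → ∑ L (λ x → k x u′))
  ∑-whenPrefix L []      u       k = refl
  ∑-whenPrefix L (a ∷ p) []      k = ∑-0 L
  ∑-whenPrefix L (a ∷ p) (b ∷ u) k =
    trans (∑-*ˡ L (eqℕ a b) _) (cong (eqℕ a b *_) (∑-whenPrefix L p u k))

  eqW-++ : ∀ p c u → eqW (p ++ c) u ≡ whenPrefix p u (eqW c)
  eqW-++ []      c u       = refl
  eqW-++ (a ∷ p) c []      = refl
  eqW-++ (a ∷ p) c (b ∷ u) = cong (eqℕ a b *_) (eqW-++ p c u)

  occ²-prepend : ∀ p q u v B →
    occ² u v (map (λ cd → (p ++ proj₁ cd , q ++ proj₂ cd)) B) ≡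
    whenPrefix p u (λ u′ → whenPrefix q v (λ v′ → occ² u′ v′ B))
  occ²-prepend p q u v B = begin
    occ² u v (map (λ cd → (p ++ proj₁ cd , q ++ proj₂ cd)) B)
      ≡⟨ ∑-map _ B _ ⟩
    ∑ B (λ cd → eqW (p ++ proj₁ cd) u * eqW (q ++ proj₂ cd) v)
      ≡⟨ ∑-cong B (λ cd → factor (proj₁ cd) (proj₂ cd)) ⟩
    ∑ B (λ cd → whenPrefix p u (λ u′ → whenPrefix q v (λ v′ → eqW (proj₁ cd) u′ * eqW (proj₂ cd) v′)))
      ≡⟨ ∑-whenPrefix B p u _ ⟩
    whenPrefix p u (λ u′ → ∑ B (λ cd → whenPrefix q v (λ v′ → eqW (proj₁ cd) u′ * eqW (proj₂ cd) v′)))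
      ≡⟨ whenPrefix-cong p u (λ u′ → ∑-whenPrefix B q v _) ⟩
    whenPrefix p u (λ u′ → whenPrefix q v (λ v′ → occ² u′ v′ B)) ∎
    where
    factor : ∀ c d → eqW (p ++ c) u * eqW (q ++ d) v ≡
                     whenPrefix p u (λ u′ → whenPrefix q v (λ v′ → eqW c u′ * eqW d v′))
    factor c d = begin
      eqW (p ++ c) u * eqW (q ++ d) v
        ≡⟨ cong₂ _*_ (eqW-++ p c u) (eqW-++ q d v) ⟩
      whenPrefix p u (eqW c) * whenPrefix q v (eqW d)
        ≡⟨ whenPrefix-*ʳ p u (eqW c) _ ⟩
      whenPrefix p u (λ u′ → eqW c u′ * whenPrefix q v (eqW d))
        ≡⟨ whenPrefix-cong p u (λ u′ → whenPrefix-*ˡ q v (eqW d) (eqW c u′)) ⟩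
      whenPrefix p u (λ u′ → whenPrefix q v (λ v′ → eqW c u′ * eqW d v′)) ∎

  occ²-mulT : ∀ u v xs ys → occ² u v (mulT xs ys) ≡
    ∑ xs (λ pq → whenPrefix (proj₁ pq) u (λ u′ → whenPrefix (proj₂ pq) v (λ v′ → occ² u′ v′ ys)))
  occ²-mulT u v xs ys =
    trans (∑-concatMap _ xs _) (∑-cong xs (λ pq → occ²-prepend (proj₁ pq) (proj₂ pq) u v ys))

  stuffing-suc : ∀ a i b → indℕ (a <? i ∸ 1) * eqℕ (i ∸ suc a) b ≡ stuffing (suc a) b i
  stuffing-suc a zero    zero    = refl
  stuffing-suc a zero    (suc b) = refl
  stuffing-suc a (suc i) zero with a <? i
  ... | no _  = refl
  ... | yes a<i =
    trans (ℕP.+-identityʳ _) (eqℕ-≢ (λ i∸a≡0 → ℕP.<-irrefl (sym i∸a≡0) (ℕP.m<n⇒0<n∸m a<i)))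
  stuffing-suc a (suc i) (suc b) with a <? i | a + suc b ℕP.≟ i
  ... | no a≮i | _ =
    sym (trans (eqℕ-suc (a + suc b) i)
               (eqℕ-≢ (λ a+b≡i → a≮i (subst (a <_) a+b≡i (ℕP.m<m+n a (s≤s z≤n))))))
  ... | yes _ | yes a+b≡i = begin
    eqℕ (i ∸ a) (suc b) + 0        ≡⟨ ℕP.+-identityʳ _ ⟩
    eqℕ (i ∸ a) (suc b)            ≡⟨ cong (λ m → eqℕ (m ∸ a) (suc b)) (sym a+b≡i) ⟩
    eqℕ (a + suc b ∸ a) (suc b)    ≡⟨ cong (λ m → eqℕ m (suc b)) (ℕP.m+n∸m≡n a (suc b)) ⟩
    eqℕ (suc b) (suc b)            ≡⟨ eqℕ-refl (suc b) ⟩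
    1                              ≡⟨ sym (indℕ-yes (a + suc b ℕP.≟ i) a+b≡i) ⟩
    eqℕ (a + suc b) i              ≡⟨ sym (eqℕ-suc (a + suc b) i) ⟩
    eqℕ (suc a + suc b) (suc i)    ∎
  ... | yes a<i | no a+b≢i = begin
    1 * eqℕ (i ∸ a) (suc b)        ≡⟨ cong (1 *_) (eqℕ-≢ i∸a≢b) ⟩
    0                              ≡⟨ sym (eqℕ-≢ a+b≢i) ⟩
    eqℕ (a + suc b) i              ≡⟨ sym (eqℕ-suc (a + suc b) i) ⟩
    eqℕ (suc a + suc b) (suc i)    ∎
    where
    i∸a≢b : i ∸ a ≢ suc b
    i∸a≢b i∸a≡b = a+b≢i (trans (cong (a +_) (sym i∸a≡b)) (ℕP.m+[n∸m]≡n (ℕP.<⇒≤ a<i)))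

  ∑-middleTerms : ∀ i a b n →
    ∑ (map suc (upTo (i ∸ 1))) (λ j → eqℕ j a * (eqℕ (i ∸ j) b * n)) ≡ stuffing a b i * n
  ∑-middleTerms i zero    b n = trans (∑-map suc (upTo (i ∸ 1)) _) (∑-0 (upTo (i ∸ 1)))
  ∑-middleTerms i (suc a) b n = begin
    ∑ J (λ j → eqℕ j (suc a) * (eqℕ (i ∸ j) b * n))
      ≡⟨ ∑-pick J (suc a) (λ j → eqℕ (i ∸ j) b * n) ⟩
    ∑ J (λ j → eqℕ j (suc a)) * (eqℕ (i ∸ suc a) b * n)
      ≡⟨ cong (_* (eqℕ (i ∸ suc a) b * n)) count ⟩
    indℕ (a <? i ∸ 1) * (eqℕ (i ∸ suc a) b * n)
      ≡⟨ sym (ℕP.*-assoc (indℕ (a <? i ∸ 1)) _ n) ⟩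
    (indℕ (a <? i ∸ 1) * eqℕ (i ∸ suc a) b) * n
      ≡⟨ cong (_* n) (stuffing-suc a i b) ⟩
    stuffing (suc a) b i * n ∎
    where
    J = map suc (upTo (i ∸ 1))
    count : ∑ J (λ j → eqℕ j (suc a)) ≡ indℕ (a <? i ∸ 1)
    count = trans (∑-map suc (upTo (i ∸ 1)) _)
                  (trans (∑-cong (upTo (i ∸ 1)) (λ k → eqℕ-suc k a)) (∑-eqℕ-upTo (i ∸ 1) a))

  qsh-[]ʳ : ∀ u → qsh u [] ≡ u ∷ []
  qsh-[]ʳ []      = refl
  qsh-[]ʳ (a ∷ u) = refl

  occ-qsh-∷ : ∀ x a u b v → occ x (qsh (a ∷ u) (b ∷ v)) ≡
    occ x (map (a ∷_) (qsh u (b ∷ v))) +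
      (occ x (map (b ∷_) (qsh (a ∷ u) v)) + occ x (extraTerm a b (qsh u v)))
  occ-qsh-∷ x a u b v =
    trans (∑-++ (map (a ∷_) (qsh u (b ∷ v))) _ _)
          (cong (occ x (map (a ∷_) (qsh u (b ∷ v))) +_) (∑-++ (map (b ∷_) (qsh (a ∷ u) v)) _ _))

  occ-qsh≡occ²-ΔWord : ∀ w u v → occ w (qsh u v) ≡ occ² u v (ΔWord w)
  occ-qsh≡occ²-ΔWord [] [] v = cong (_+ 0) (trans (eqW-sym v []) (sym (ℕP.*-identityˡ (eqW [] v))))
  occ-qsh≡occ²-ΔWord [] (a ∷ u) []      = refl
  occ-qsh≡occ²-ΔWord [] (a ∷ u) (b ∷ v) =
    trans (occ-qsh-∷ [] a u b v)
          (cong₂ _+_ (occ-[]-map-∷ a (qsh u (b ∷ v)))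
                     (cong₂ _+_ (occ-[]-map-∷ b (qsh (a ∷ u) v)) (occ-[]-extraTerm a b (qsh u v))))
  occ-qsh≡occ²-ΔWord (i ∷ w) u v = trans (byFirstLetter u v) (sym (occ²-mulT u v (ΔLetter i) B))
    where
    B = ΔWord w
    J = map suc (upTo (i ∸ 1))
    IH = occ-qsh≡occ²-ΔWord w

    middleTerms : Word → Word → ℕ
    middleTerms u v = ∑ (map (λ j → (j ∷ [] , (i ∸ j) ∷ [])) J)
      (λ pq → whenPrefix (proj₁ pq) u (λ u′ → whenPrefix (proj₂ pq) v (λ v′ → occ² u′ v′ B)))

    middleTerms-[]ˡ : ∀ v → middleTerms [] v ≡ 0
    middleTerms-[]ˡ v = trans (∑-map _ J _) (∑-0 J)

    middleTerms-[]ʳ : ∀ u → middleTerms u [] ≡ 0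
    middleTerms-[]ʳ []      = middleTerms-[]ˡ []
    middleTerms-[]ʳ (a ∷ u) = trans (∑-map _ J _) (trans (∑-cong J (λ j → ℕP.*-zeroʳ (eqℕ j a))) (∑-0 J))

    byFirstLetter : ∀ u v → occ (i ∷ w) (qsh u v) ≡
      ∑ (ΔLetter i) (λ pq → whenPrefix (proj₁ pq) u (λ u′ →
                              whenPrefix (proj₂ pq) v (λ v′ → occ² u′ v′ B)))
    byFirstLetter [] [] = sym (middleTerms-[]ˡ [])
    byFirstLetter [] (b ∷ v) =
      cong₂ _+_ (cong₂ _*_ (eqℕ-sym b i) (trans (sym (ℕP.+-identityʳ (eqW v w))) (IH [] v)))
                (sym (middleTerms-[]ˡ (b ∷ v)))
    byFirstLetter (a ∷ u) [] =
      cong₂ _+_ (cong₂ _*_ (eqℕ-sym a i) (trans (sym (ℕP.+-identityʳ (eqW u w)))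
                                                (trans (cong (occ w) (sym (qsh-[]ʳ u))) (IH u []))))
                (sym (middleTerms-[]ʳ (a ∷ u)))
    byFirstLetter (a ∷ u) (b ∷ v) = begin
      occ (i ∷ w) (qsh (a ∷ u) (b ∷ v))
        ≡⟨ occ-qsh-∷ (i ∷ w) a u b v ⟩
      occ (i ∷ w) (map (a ∷_) (qsh u (b ∷ v))) +
        (occ (i ∷ w) (map (b ∷_) (qsh (a ∷ u) v)) + occ (i ∷ w) (extraTerm a b (qsh u v)))
        ≡⟨ cong₂ _+_ (occ-map-∷ a i w (qsh u (b ∷ v)))
                     (cong₂ _+_ (occ-map-∷ b i w (qsh (a ∷ u) v)) (occ-extraTerm a b i w (qsh u v))) ⟩
      eqℕ a i * occ w (qsh u (b ∷ v)) + (eqℕ b i * occ w (qsh (a ∷ u) v) + stuffing a b i * occ w (qsh u v))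
        ≡⟨ cong₂ _+_ (cong₂ _*_ (eqℕ-sym a i) (IH u (b ∷ v)))
                     (cong₂ _+_ (cong₂ _*_ (eqℕ-sym b i) (IH (a ∷ u) v)) (cong (stuffing a b i *_) (IH u v))) ⟩
      eqℕ i a * occ² u (b ∷ v) B + (eqℕ i b * occ² (a ∷ u) v B + stuffing a b i * occ² u v B)
        ≡⟨ +-leftComm (eqℕ i a * occ² u (b ∷ v) B) _ (stuffing a b i * occ² u v B) ⟩
      eqℕ i b * occ² (a ∷ u) v B + (eqℕ i a * occ² u (b ∷ v) B + stuffing a b i * occ² u v B)
        ≡⟨ cong (λ m → eqℕ i b * occ² (a ∷ u) v B + (eqℕ i a * occ² u (b ∷ v) B + m))
                (sym (trans (∑-map _ J _) (∑-middleTerms i a b (occ² u v B)))) ⟩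
      eqℕ i b * occ² (a ∷ u) v B + (eqℕ i a * occ² u (b ∷ v) B + middleTerms (a ∷ u) (b ∷ v)) ∎

  letterWeight : ℕ → ℕ
  letterWeight zero    = 1
  letterWeight (suc i) = suc i

  weight-∷ : ∀ a x → weight (a ∷ x) ≡ letterWeight a + weight x
  weight-∷ zero    x = refl
  weight-∷ (suc a) x = refl

  qsh-weight : ∀ u v → All (λ x → weight x ≡ weight u + weight v) (qsh u v)
  qsh-weight []      v       = refl ∷ []
  qsh-weight (a ∷ u) []      = sym (ℕP.+-identityʳ _) ∷ []
  qsh-weight (a ∷ u) (b ∷ v) =
    AllP.++⁺ (AllP.map⁺ (All.map viaLeft (qsh-weight u (b ∷ v))))
      (AllP.++⁺ (AllP.map⁺ (All.map viaRight (qsh-weight (a ∷ u) v))) (viaStuffing a b (qsh u v) (qsh-weight u v)))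
    where
    viaLeft : ∀ {x} → weight x ≡ weight u + weight (b ∷ v) →
              weight (a ∷ x) ≡ weight (a ∷ u) + weight (b ∷ v)
    viaLeft {x} wx = begin
      weight (a ∷ x)                                  ≡⟨ weight-∷ a x ⟩
      letterWeight a + weight x                       ≡⟨ cong (letterWeight a +_) wx ⟩
      letterWeight a + (weight u + weight (b ∷ v))    ≡⟨ sym (ℕP.+-assoc (letterWeight a) _ _) ⟩
      (letterWeight a + weight u) + weight (b ∷ v)    ≡⟨ cong (_+ weight (b ∷ v)) (sym (weight-∷ a u)) ⟩
      weight (a ∷ u) + weight (b ∷ v)                 ∎
    viaRight : ∀ {x} → weight x ≡ weight (a ∷ u) + weight v →
               weight (b ∷ x) ≡ weight (a ∷ u) + weight (b ∷ v)
    viaRight {x} wx = begin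
      weight (b ∷ x)                                  ≡⟨ weight-∷ b x ⟩
      letterWeight b + weight x                       ≡⟨ cong (letterWeight b +_) wx ⟩
      letterWeight b + (weight (a ∷ u) + weight v)    ≡⟨ +-leftComm (letterWeight b) (weight (a ∷ u)) (weight v) ⟩
      weight (a ∷ u) + (letterWeight b + weight v)    ≡⟨ cong (weight (a ∷ u) +_) (sym (weight-∷ b v)) ⟩
      weight (a ∷ u) + weight (b ∷ v)                 ∎
    viaStuffing : ∀ a b L → All (λ x → weight x ≡ weight u + weight v) L →
                  All (λ x → weight x ≡ weight (a ∷ u) + weight (b ∷ v)) (extraTerm a b L)
    viaStuffing zero    b       L _   = []
    viaStuffing (suc a) zero    L _   = []
    viaStuffing (suc a) (suc b) L wts = AllP.map⁺ (All.map (λ {x} → stuffed {x}) wts)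
      where
      stuffed : ∀ {x : Word} → weight x ≡ weight u + weight v →
                weight ((suc a + suc b) ∷ x) ≡ weight (suc a ∷ u) + weight (suc b ∷ v)
      stuffed wx = trans (cong ((suc a + suc b) +_) wx) (+-interchange (suc a) (suc b) (weight u) (weight v))

  lettersAtMost : ℕ → Word → ℕ
  lettersAtMost n []      = 1
  lettersAtMost n (b ∷ x) = indℕ (b ≤? n) * lettersAtMost n x

  occ-wordsOfLen : ∀ n k x → occ x (wordsOfLen n k) ≡ eqℕ (length x) k * lettersAtMost n x
  occ-wordsOfLen n zero    []      = refl
  occ-wordsOfLen n zero    (b ∷ x) = refl
  occ-wordsOfLen n (suc k) []      =
    trans (∑-concatMap (λ a → map (a ∷_) (wordsOfLen n k)) (upTo (suc n)) (λ y → eqW y []))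
          (trans (∑-cong (upTo (suc n)) (λ a → occ-[]-map-∷ a (wordsOfLen n k))) (∑-0 (upTo (suc n))))
  occ-wordsOfLen n (suc k) (b ∷ x) = begin
    occ (b ∷ x) (concatMap (λ a → map (a ∷_) (wordsOfLen n k)) (upTo (suc n)))
      ≡⟨ ∑-concatMap (λ a → map (a ∷_) (wordsOfLen n k)) (upTo (suc n)) (λ y → eqW y (b ∷ x)) ⟩
    ∑ (upTo (suc n)) (λ a → occ (b ∷ x) (map (a ∷_) (wordsOfLen n k)))
      ≡⟨ ∑-cong (upTo (suc n)) (λ a → occ-map-∷ a b x (wordsOfLen n k)) ⟩
    ∑ (upTo (suc n)) (λ a → eqℕ a b * occ x (wordsOfLen n k))
      ≡⟨ ∑-pick (upTo (suc n)) b (λ _ → occ x (wordsOfLen n k)) ⟩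
    ∑ (upTo (suc n)) (λ a → eqℕ a b) * occ x (wordsOfLen n k)
      ≡⟨ cong₂ _*_ (trans (∑-eqℕ-upTo (suc n) b) (indℕ-⇔ (b <? suc n) (b ≤? n) ℕP.≤-pred s≤s))
                   (occ-wordsOfLen n k x) ⟩
    indℕ (b ≤? n) * (eqℕ (length x) k * lettersAtMost n x)
      ≡⟨ *-leftComm (indℕ (b ≤? n)) (eqℕ (length x) k) (lettersAtMost n x) ⟩
    eqℕ (length x) k * (indℕ (b ≤? n) * lettersAtMost n x)
      ≡⟨ cong (_* lettersAtMost n (b ∷ x)) (sym (eqℕ-suc (length x) k)) ⟩
    eqℕ (suc (length x)) (suc k) * lettersAtMost n (b ∷ x) ∎

  length≤weight : ∀ x → length x ≤ weight x
  length≤weight []          = z≤n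
  length≤weight (zero ∷ x)  = s≤s (length≤weight x)
  length≤weight (suc a ∷ x) = ℕP.≤-trans (s≤s (length≤weight x)) (s≤s (ℕP.m≤n+m (weight x) a))

  lettersAtMost-weight : ∀ n x → weight x ≤ n → lettersAtMost n x ≡ 1
  lettersAtMost-weight n []      _   = refl
  lettersAtMost-weight n (b ∷ x) b∷x≤n =
    cong₂ _*_ (indℕ-yes (b ≤? n) (ℕP.≤-trans (letter≤ b) ≤n))
              (lettersAtMost-weight n x (ℕP.≤-trans (ℕP.m≤n+m (weight x) (letterWeight b)) ≤n))
    where
    ≤n : letterWeight b + weight x ≤ n
    ≤n = subst (_≤ n) (weight-∷ b x) b∷x≤n
    letter≤ : ∀ b → b ≤ letterWeight b + weight x
    letter≤ zero    = z≤n
    letter≤ (suc b) = ℕP.m≤m+n (suc b) (weight x)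

  occ-filter : ∀ {p} {P : Word → Set p} (P? : ∀ w → Dec (P w)) x L → P x → occ x (filter P? L) ≡ occ x L
  occ-filter P? x []      px = refl
  occ-filter P? x (y ∷ L) px with P? y
  ... | yes _  = cong (eqW y x +_) (occ-filter P? x L px)
  ... | no ¬py with eqW≡0⊎≡ y x
  ...   | inj₁ y≠x  = trans (occ-filter P? x L px) (cong (_+ occ x L) (sym y≠x))
  ...   | inj₂ refl = ⊥-elim (¬py px)

  occ-wordsOfWeight : ∀ x → occ x (wordsOfWeight (weight x)) ≡ 1
  occ-wordsOfWeight x = begin
    occ x (wordsOfWeight n)
      ≡⟨ occ-filter (λ w → weight w ℕP.≟ n) x (concatMap (wordsOfLen n) (upTo (suc n))) refl ⟩
    occ x (concatMap (wordsOfLen n) (upTo (suc n)))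
      ≡⟨ ∑-concatMap (wordsOfLen n) (upTo (suc n)) (λ y → eqW y x) ⟩
    ∑ (upTo (suc n)) (λ k → occ x (wordsOfLen n k))
      ≡⟨ ∑-cong (upTo (suc n)) (λ k →
           trans (occ-wordsOfLen n k x) (cong (_* lettersAtMost n x) (eqℕ-sym (length x) k))) ⟩
    ∑ (upTo (suc n)) (λ k → eqℕ k (length x) * lettersAtMost n x)
      ≡⟨ ∑-*ʳ (upTo (suc n)) (lettersAtMost n x) (λ k → eqℕ k (length x)) ⟩
    ∑ (upTo (suc n)) (λ k → eqℕ k (length x)) * lettersAtMost n x
      ≡⟨ cong₂ _*_ (trans (∑-eqℕ-upTo (suc n) (length x))
                          (indℕ-yes (length x <? suc n) (s≤s (length≤weight x))))
                   (lettersAtMost-weight n x ℕP.≤-refl) ⟩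
    1 ∎
    where n = weight x

  occ-wordsOfWeight-qsh : ∀ u v → All (λ x → occ x (wordsOfWeight (weight u + weight v)) ≡ 1) (qsh u v)
  occ-wordsOfWeight-qsh u v =
    All.map (λ {x} wt → subst (λ n → occ x (wordsOfWeight n) ≡ 1) wt (occ-wordsOfWeight x)) (qsh-weight u v)

module SeriesHopf {c ℓ} (R : CommutativeRing c ℓ) where
  open import Data.Nat using (ℕ; zero; suc; _≤_; z≤n; s≤s) renaming (_+_ to _+ℕ_; _*_ to _*ℕ_)
  open Series R
  open CommutativeRing R
  open ListSum semiring
  open Multiplicity
    using (indℕ; eqW; eqW≡indℕ; eqW≡0⊎≡; eqW-sym; occ; occ²; occ-qsh≡occ²-ΔWord; occ-wordsOfWeight-qsh)
  open import Relation.Binary.Reasoning.Setoid setoid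
  open import Algebra.Properties.Ring ring using (-‿distribʳ-*; -‿+-comm)
  open import Algebra.Properties.CommutativeSemigroup +-commutativeSemigroup
    using (interchange) renaming (x∙yz≈y∙xz to +-leftComm)
  import Algebra.Solver.CommutativeMonoid +-commutativeMonoid as +-Solver
  open +-Solver using (_⊕_; _⊜_)
  module ℕ∑ = ListSum ℕP.+-*-semiring

  -- Coefficients of Δb

  natR-+ : ∀ m n → natR (m +ℕ n) ≈ natR m + natR n
  natR-+ zero    n = sym (+-identityˡ _)
  natR-+ (suc m) n = trans (+-congˡ (natR-+ m n)) (sym (+-assoc _ _ _))

  natR-* : ∀ m n → natR (m *ℕ n) ≈ natR m * natR n
  natR-* zero    n = sym (zeroˡ _)
  natR-* (suc m) n = begin
    natR (n +ℕ m *ℕ n)             ≈⟨ natR-+ n (m *ℕ n) ⟩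
    natR n + natR (m *ℕ n)         ≈⟨ +-cong (sym (*-identityˡ _)) (natR-* m n) ⟩
    1# * natR n + natR m * natR n  ≈⟨ sym (distribʳ _ _ _) ⟩
    (1# + natR m) * natR n         ∎

  natR-1-* : ∀ r → natR 1 * r ≈ r
  natR-1-* r = trans (*-congʳ (+-identityʳ 1#)) (*-identityˡ r)

  natR-∑ : ∀ {A : Set} (xs : List A) f → natR (ℕ∑.∑ xs f) ≈ ΣL xs (λ x → natR (f x))
  natR-∑ []       f = refl
  natR-∑ (x ∷ xs) f = trans (natR-+ (f x) _) (+-congˡ (natR-∑ xs f))

  ind≈natR-indℕ : ∀ {P : Set} (d : Dec P) → ind d ≈ natR (indℕ d)
  ind≈natR-indℕ (yes _) = sym (+-identityʳ 1#)
  ind≈natR-indℕ (no _)  = refl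

  ind-pair≈natR : ∀ u v x y → ind (x ≟W u) * ind (y ≟W v) ≈ natR (eqW x u *ℕ eqW y v)
  ind-pair≈natR u v x y = begin
    ind (x ≟W u) * ind (y ≟W v)
      ≈⟨ *-cong (ind≈natR-indℕ (x ≟W u)) (ind≈natR-indℕ (y ≟W v)) ⟩
    natR (indℕ (x ≟W u)) * natR (indℕ (y ≟W v))
      ≈⟨ sym (natR-* (indℕ (x ≟W u)) (indℕ (y ≟W v))) ⟩
    natR (indℕ (x ≟W u) *ℕ indℕ (y ≟W v))
      ≈⟨ reflexive (≡.cong₂ (λ m n → natR (m *ℕ n)) (≡.sym (eqW≡indℕ x u)) (≡.sym (eqW≡indℕ y v))) ⟩
    natR (eqW x u *ℕ eqW y v) ∎

  ∑-indicators : ∀ u v r Ps →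
    ΣL Ps (λ { (x , y) → (ind (x ≟W u) * ind (y ≟W v)) * r }) ≈ natR (occ² u v Ps) * r
  ∑-indicators u v r Ps = begin
    ΣL Ps (λ { (x , y) → (ind (x ≟W u) * ind (y ≟W v)) * r })
      ≈⟨ ∑-cong Ps (λ p → *-congʳ (ind-pair≈natR u v (proj₁ p) (proj₂ p))) ⟩
    ΣL Ps (λ p → natR (eqW (proj₁ p) u *ℕ eqW (proj₂ p) v) * r)
      ≈⟨ ∑-*ʳ Ps r _ ⟩
    ΣL Ps (λ p → natR (eqW (proj₁ p) u *ℕ eqW (proj₂ p) v)) * r
      ≈⟨ *-congʳ (sym (natR-∑ Ps _)) ⟩
    natR (occ² u v Ps) * r ∎

  natR-eqW-transport : ∀ (Φ : Ser) x w → natR (eqW x w) * Φ w ≈ natR (eqW w x) * Φ x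
  natR-eqW-transport Φ x w with eqW≡0⊎≡ x w
  ... | inj₂ ≡.refl = refl
  ... | inj₁ x≠w    = begin
    natR (eqW x w) * Φ w ≈⟨ *-congʳ (reflexive (≡.cong natR x≠w)) ⟩
    0# * Φ w             ≈⟨ zeroˡ _ ⟩
    0#                   ≈⟨ sym (zeroˡ _) ⟩
    0# * Φ x             ≈⟨ *-congʳ (reflexive (≡.cong natR (≡.sym (≡.trans (eqW-sym w x) x≠w)))) ⟩
    natR (eqW w x) * Φ x ∎

  ∑-weightedByOcc : ∀ (Φ : Ser) W L → All (λ x → occ x W ≡.≡ 1) L →
                    ΣL W (λ w → natR (occ w L) * Φ w) ≈ ΣL L Φ
  ∑-weightedByOcc Φ W L onceInW = begin
    ΣL W (λ w → natR (occ w L) * Φ w)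
      ≈⟨ ∑-cong W (λ w → trans (*-congʳ (natR-∑ L _)) (sym (∑-*ʳ L (Φ w) _))) ⟩
    ΣL W (λ w → ΣL L (λ x → natR (eqW x w) * Φ w))
      ≈⟨ ∑-swap W L _ ⟩
    ΣL L (λ x → ΣL W (λ w → natR (eqW x w) * Φ w))
      ≈⟨ ∑-cong L (λ x → ∑-cong W (natR-eqW-transport Φ x)) ⟩
    ΣL L (λ x → ΣL W (λ w → natR (eqW w x) * Φ x))
      ≈⟨ ∑-cong L (λ x → trans (∑-*ʳ W (Φ x) _) (*-congʳ (sym (natR-∑ W _)))) ⟩
    ΣL L (λ x → natR (occ x W) * Φ x)
      ≈⟨ ∑-cong-All (All.map (λ occ≡1 → trans (*-congʳ (reflexive (≡.cong natR occ≡1))) (natR-1-* _))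
                             onceInW) ⟩
    ΣL L Φ ∎

  ⟨_∣_∗_⟩ : Ser → Word → Word → Carrier
  ⟨ Φ ∣ u ∗ v ⟩ = ΣL (qsh u v) Φ

  Δb≈∑qsh : ∀ Φ u v → Δb Φ u v ≈ ⟨ Φ ∣ u ∗ v ⟩
  Δb≈∑qsh Φ u v = begin
    Δb Φ u v
      ≈⟨ ∑-cong W (λ w → ∑-indicators u v (Φ w) (ΔWord w)) ⟩
    ΣL W (λ w → natR (occ² u v (ΔWord w)) * Φ w)
      ≈⟨ ∑-cong W (λ w → reflexive (≡.cong (λ n → natR n * Φ w) (≡.sym (occ-qsh≡occ²-ΔWord w u v)))) ⟩
    ΣL W (λ w → natR (occ w (qsh u v)) * Φ w)
      ≈⟨ ∑-weightedByOcc Φ W (qsh u v) (occ-wordsOfWeight-qsh u v) ⟩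
    ⟨ Φ ∣ u ∗ v ⟩ ∎
    where W = wordsOfWeight (weight u +ℕ weight v)

  -- Algebra of the quasi-shuffle pairing

  ∂ : ℕ → Ser → Ser
  ∂ a Φ w = Φ (a ∷ w)

  δ : ℕ → ℕ → Carrier → Carrier
  δ (suc a) (suc b) r = r
  δ _       _       r = 0#

  δ-cong : ∀ a b {r s} → r ≈ s → δ a b r ≈ δ a b s
  δ-cong zero    b       r≈s = refl
  δ-cong (suc a) zero    r≈s = refl
  δ-cong (suc a) (suc b) r≈s = r≈s

  δ-0 : ∀ a b → δ a b 0# ≈ 0#
  δ-0 zero    b       = refl
  δ-0 (suc a) zero    = refl
  δ-0 (suc a) (suc b) = refl

  δ-+ : ∀ a b r s → δ a b (r + s) ≈ δ a b r + δ a b s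
  δ-+ zero    b       r s = sym (+-identityˡ 0#)
  δ-+ (suc a) zero    r s = sym (+-identityˡ 0#)
  δ-+ (suc a) (suc b) r s = refl

  δ-*ˡ : ∀ a b r s → δ a b (r * s) ≈ r * δ a b s
  δ-*ˡ zero    b       r s = sym (zeroʳ r)
  δ-*ˡ (suc a) zero    r s = sym (zeroʳ r)
  δ-*ˡ (suc a) (suc b) r s = refl

  δ-*ʳ : ∀ a b r s → δ a b (s * r) ≈ δ a b s * r
  δ-*ʳ zero    b       r s = sym (zeroˡ r)
  δ-*ʳ (suc a) zero    r s = sym (zeroˡ r)
  δ-*ʳ (suc a) (suc b) r s = refl

  ∑-δ : ∀ {A : Set} a b (xs : List A) f → ΣL xs (λ x → δ a b (f x)) ≈ δ a b (ΣL xs f)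
  ∑-δ zero    b       xs f = ∑-0 xs
  ∑-δ (suc a) zero    xs f = ∑-0 xs
  ∑-δ (suc a) (suc b) xs f = refl

  δ-comm : ∀ a b (f : ℕ → Carrier) → δ a b (f (a +ℕ b)) ≈ δ b a (f (b +ℕ a))
  δ-comm zero    zero    f = refl
  δ-comm zero    (suc b) f = refl
  δ-comm (suc a) zero    f = refl
  δ-comm (suc a) (suc b) f = reflexive (≡.cong f (ℕP.+-comm (suc a) (suc b)))

  ∑-extraTerm : ∀ a b L Φ → ΣL (extraTerm a b L) Φ ≈ δ a b (ΣL L (∂ (a +ℕ b) Φ))
  ∑-extraTerm zero    b       L Φ = refl
  ∑-extraTerm (suc a) zero    L Φ = refl
  ∑-extraTerm (suc a) (suc b) L Φ = ∑-map _ L Φ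

  ∗-identityˡ : ∀ Φ v → ⟨ Φ ∣ [] ∗ v ⟩ ≈ Φ v
  ∗-identityˡ Φ v = +-identityʳ _

  ∗-identityʳ : ∀ Φ u → ⟨ Φ ∣ u ∗ [] ⟩ ≈ Φ u
  ∗-identityʳ Φ []      = +-identityʳ _
  ∗-identityʳ Φ (a ∷ u) = +-identityʳ _

  ∑-qsh-∷ : ∀ a u b v (G : Word → Carrier) → ΣL (qsh (a ∷ u) (b ∷ v)) G ≈
    ΣL (map (a ∷_) (qsh u (b ∷ v))) G + (ΣL (map (b ∷_) (qsh (a ∷ u) v)) G + ΣL (extraTerm a b (qsh u v)) G)
  ∑-qsh-∷ a u b v G =
    trans (∑-++ (map (a ∷_) (qsh u (b ∷ v))) _ G) (+-congˡ (∑-++ (map (b ∷_) (qsh (a ∷ u) v)) _ G))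

  ∗-∷ : ∀ Φ a u b v → ⟨ Φ ∣ a ∷ u ∗ b ∷ v ⟩ ≈
        ⟨ ∂ a Φ ∣ u ∗ b ∷ v ⟩ + (⟨ ∂ b Φ ∣ a ∷ u ∗ v ⟩ + δ a b ⟨ ∂ (a +ℕ b) Φ ∣ u ∗ v ⟩)
  ∗-∷ Φ a u b v = begin
    ΣL (map (a ∷_) (qsh u (b ∷ v)) ++ map (b ∷_) (qsh (a ∷ u) v) ++ extraTerm a b (qsh u v)) Φ
      ≈⟨ ∑-qsh-∷ a u b v Φ ⟩
    ΣL (map (a ∷_) (qsh u (b ∷ v))) Φ + (ΣL (map (b ∷_) (qsh (a ∷ u) v)) Φ + ΣL (extraTerm a b (qsh u v)) Φ)
      ≈⟨ +-cong (∑-map _ (qsh u (b ∷ v)) Φ) (+-cong (∑-map _ (qsh (a ∷ u) v) Φ) (∑-extraTerm a b (qsh u v) Φ)) ⟩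
    ⟨ ∂ a Φ ∣ u ∗ b ∷ v ⟩ + (⟨ ∂ b Φ ∣ a ∷ u ∗ v ⟩ + δ a b ⟨ ∂ (a +ℕ b) Φ ∣ u ∗ v ⟩) ∎

  ∗-comm : ∀ Φ u v → ⟨ Φ ∣ u ∗ v ⟩ ≈ ⟨ Φ ∣ v ∗ u ⟩
  ∗-comm Φ []      []      = refl
  ∗-comm Φ []      (b ∷ v) = refl
  ∗-comm Φ (a ∷ u) []      = refl
  ∗-comm Φ (a ∷ u) (b ∷ v) = begin
    ⟨ Φ ∣ a ∷ u ∗ b ∷ v ⟩
      ≈⟨ ∗-∷ Φ a u b v ⟩
    ⟨ ∂ a Φ ∣ u ∗ b ∷ v ⟩ + (⟨ ∂ b Φ ∣ a ∷ u ∗ v ⟩ + δ a b ⟨ ∂ (a +ℕ b) Φ ∣ u ∗ v ⟩)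
      ≈⟨ +-cong (∗-comm (∂ a Φ) u (b ∷ v)) (+-cong (∗-comm (∂ b Φ) (a ∷ u) v)
           (trans (δ-cong a b (∗-comm _ u v)) (δ-comm a b (λ n → ⟨ ∂ n Φ ∣ v ∗ u ⟩)))) ⟩
    ⟨ ∂ a Φ ∣ b ∷ v ∗ u ⟩ + (⟨ ∂ b Φ ∣ v ∗ a ∷ u ⟩ + δ b a ⟨ ∂ (b +ℕ a) Φ ∣ v ∗ u ⟩)
      ≈⟨ +-leftComm _ _ _ ⟩
    ⟨ ∂ b Φ ∣ v ∗ a ∷ u ⟩ + (⟨ ∂ a Φ ∣ b ∷ v ∗ u ⟩ + δ b a ⟨ ∂ (b +ℕ a) Φ ∣ v ∗ u ⟩)
      ≈⟨ sym (∗-∷ Φ b v a u) ⟩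
    ⟨ Φ ∣ b ∷ v ∗ a ∷ u ⟩ ∎

  ⟨_∣⦅_∗_⦆∗_⟩ : Ser → Word → Word → Word → Carrier
  ⟨ Φ ∣⦅ u ∗ v ⦆∗ w ⟩ = ΣL (qsh u v) (λ x → ⟨ Φ ∣ x ∗ w ⟩)

  ⟨_∣_∗⦅_∗_⦆⟩ : Ser → Word → Word → Word → Carrier
  ⟨ Φ ∣ u ∗⦅ v ∗ w ⦆⟩ = ΣL (qsh v w) (λ x → ⟨ Φ ∣ u ∗ x ⟩)

  ∑-∗-∷ : ∀ Φ a L c w → ΣL (map (a ∷_) L) (λ x → ⟨ Φ ∣ x ∗ c ∷ w ⟩) ≈
    ΣL L (λ x → ⟨ ∂ a Φ ∣ x ∗ c ∷ w ⟩) +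
      (ΣL (map (a ∷_) L) (λ x → ⟨ ∂ c Φ ∣ x ∗ w ⟩) + δ a c (ΣL L (λ x → ⟨ ∂ (a +ℕ c) Φ ∣ x ∗ w ⟩)))
  ∑-∗-∷ Φ a L c w = begin
    ΣL (map (a ∷_) L) (λ x → ⟨ Φ ∣ x ∗ c ∷ w ⟩)
      ≈⟨ trans (∑-map (a ∷_) L _) (∑-cong L (λ x → ∗-∷ Φ a x c w)) ⟩
    ΣL L (λ x → ⟨ ∂ a Φ ∣ x ∗ c ∷ w ⟩ + (⟨ ∂ c Φ ∣ a ∷ x ∗ w ⟩ + δ a c ⟨ ∂ (a +ℕ c) Φ ∣ x ∗ w ⟩))
      ≈⟨ trans (∑-+ L _ _) (+-congˡ (∑-+ L _ _)) ⟩
    ΣL L (λ x → ⟨ ∂ a Φ ∣ x ∗ c ∷ w ⟩) +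
      (ΣL L (λ x → ⟨ ∂ c Φ ∣ a ∷ x ∗ w ⟩) + ΣL L (λ x → δ a c ⟨ ∂ (a +ℕ c) Φ ∣ x ∗ w ⟩))
      ≈⟨ +-congˡ (+-cong (sym (∑-map (a ∷_) L _)) (∑-δ a c L _)) ⟩
    _ ∎

  ∑-extraTerm-∗-∷ : ∀ Φ a b L c w → ΣL (extraTerm a b L) (λ x → ⟨ Φ ∣ x ∗ c ∷ w ⟩) ≈
    δ a b (ΣL L (λ x → ⟨ ∂ (a +ℕ b) Φ ∣ x ∗ c ∷ w ⟩)) +
      (ΣL (extraTerm a b L) (λ x → ⟨ ∂ c Φ ∣ x ∗ w ⟩) +
       δ a b (δ (a +ℕ b) c (ΣL L (λ x → ⟨ ∂ ((a +ℕ b) +ℕ c) Φ ∣ x ∗ w ⟩))))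
  ∑-extraTerm-∗-∷ Φ zero    b       L c w = sym (trans (+-identityˡ _) (+-identityˡ 0#))
  ∑-extraTerm-∗-∷ Φ (suc a) zero    L c w = sym (trans (+-identityˡ _) (+-identityˡ 0#))
  ∑-extraTerm-∗-∷ Φ (suc a) (suc b) L c w = ∑-∗-∷ Φ (suc a +ℕ suc b) L c w

  ∗∗-∷ : ∀ Φ a u b v c w → ⟨ Φ ∣⦅ a ∷ u ∗ b ∷ v ⦆∗ c ∷ w ⟩ ≈
    ⟨ ∂ a Φ ∣⦅ u ∗ b ∷ v ⦆∗ c ∷ w ⟩ +
    (⟨ ∂ b Φ ∣⦅ a ∷ u ∗ v ⦆∗ c ∷ w ⟩ +
    (⟨ ∂ c Φ ∣⦅ a ∷ u ∗ b ∷ v ⦆∗ w ⟩ +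
    (δ a b ⟨ ∂ (a +ℕ b) Φ ∣⦅ u ∗ v ⦆∗ c ∷ w ⟩ +
    (δ a c ⟨ ∂ (a +ℕ c) Φ ∣⦅ u ∗ b ∷ v ⦆∗ w ⟩ +
    (δ b c ⟨ ∂ (b +ℕ c) Φ ∣⦅ a ∷ u ∗ v ⦆∗ w ⟩ +
     δ a b (δ (a +ℕ b) c ⟨ ∂ ((a +ℕ b) +ℕ c) Φ ∣⦅ u ∗ v ⦆∗ w ⟩))))))
  ∗∗-∷ Φ a u b v c w = begin
    ⟨ Φ ∣⦅ a ∷ u ∗ b ∷ v ⦆∗ c ∷ w ⟩
      ≈⟨ ∑-qsh-∷ a u b v _ ⟩
    ΣL (map (a ∷_) (qsh u (b ∷ v))) (λ x → ⟨ Φ ∣ x ∗ c ∷ w ⟩) +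
      (ΣL (map (b ∷_) (qsh (a ∷ u) v)) (λ x → ⟨ Φ ∣ x ∗ c ∷ w ⟩) +
       ΣL (extraTerm a b (qsh u v)) (λ x → ⟨ Φ ∣ x ∗ c ∷ w ⟩))
      ≈⟨ +-cong (∑-∗-∷ Φ a (qsh u (b ∷ v)) c w)
           (+-cong (∑-∗-∷ Φ b (qsh (a ∷ u) v) c w) (∑-extraTerm-∗-∷ Φ a b (qsh u v) c w)) ⟩
    (A₁ + (M₁ + A₂)) + ((B₁ + (M₂ + B₂)) + (E₁ + (M₃ + E₂)))
      ≈⟨ +-Solver.solve 9 (λ A₁ M₁ A₂ B₁ M₂ B₂ E₁ M₃ E₂ →
           (A₁ ⊕ (M₁ ⊕ A₂)) ⊕ ((B₁ ⊕ (M₂ ⊕ B₂)) ⊕ (E₁ ⊕ (M₃ ⊕ E₂))) ⊜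
           A₁ ⊕ (B₁ ⊕ ((M₁ ⊕ (M₂ ⊕ M₃)) ⊕ (E₁ ⊕ (A₂ ⊕ (B₂ ⊕ E₂))))))
           refl A₁ M₁ A₂ B₁ M₂ B₂ E₁ M₃ E₂ ⟩
    A₁ + (B₁ + ((M₁ + (M₂ + M₃)) + (E₁ + (A₂ + (B₂ + E₂)))))
      ≈⟨ +-congˡ (+-congˡ (+-congʳ (sym (∑-qsh-∷ a u b v _)))) ⟩
    _ ∎
    where
    A₁ = ⟨ ∂ a Φ ∣⦅ u ∗ b ∷ v ⦆∗ c ∷ w ⟩
    A₂ = δ a c ⟨ ∂ (a +ℕ c) Φ ∣⦅ u ∗ b ∷ v ⦆∗ w ⟩
    B₁ = ⟨ ∂ b Φ ∣⦅ a ∷ u ∗ v ⦆∗ c ∷ w ⟩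
    B₂ = δ b c ⟨ ∂ (b +ℕ c) Φ ∣⦅ a ∷ u ∗ v ⦆∗ w ⟩
    E₁ = δ a b ⟨ ∂ (a +ℕ b) Φ ∣⦅ u ∗ v ⦆∗ c ∷ w ⟩
    E₂ = δ a b (δ (a +ℕ b) c ⟨ ∂ ((a +ℕ b) +ℕ c) Φ ∣⦅ u ∗ v ⦆∗ w ⟩)
    M₁ = ΣL (map (a ∷_) (qsh u (b ∷ v))) (λ x → ⟨ ∂ c Φ ∣ x ∗ w ⟩)
    M₂ = ΣL (map (b ∷_) (qsh (a ∷ u) v)) (λ x → ⟨ ∂ c Φ ∣ x ∗ w ⟩)
    M₃ = ΣL (extraTerm a b (qsh u v)) (λ x → ⟨ ∂ c Φ ∣ x ∗ w ⟩)

  δ-rotate : ∀ a b c (f : ℕ → Carrier) →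
             δ a b (δ (a +ℕ b) c (f ((a +ℕ b) +ℕ c))) ≈ δ b c (δ (b +ℕ c) a (f ((b +ℕ c) +ℕ a)))
  δ-rotate zero    zero    c       f = refl
  δ-rotate zero    (suc b) zero    f = refl
  δ-rotate zero    (suc b) (suc c) f = refl
  δ-rotate (suc a) zero    zero    f = refl
  δ-rotate (suc a) zero    (suc c) f = refl
  δ-rotate (suc a) (suc b) zero    f = refl
  δ-rotate (suc a) (suc b) (suc c) f =
    reflexive (≡.cong f (≡.trans (ℕP.+-assoc (suc a) (suc b) (suc c)) (ℕP.+-comm (suc a) (suc b +ℕ suc c))))

  -- With ∗ commutative, associativity amounts to invariance of ⟨ Φ ∣ (u ∗ v) ∗ w ⟩ under rotating (u, v, w).
  ∗∗-rotate : ∀ Φ u v w → ⟨ Φ ∣⦅ u ∗ v ⦆∗ w ⟩ ≈ ⟨ Φ ∣⦅ v ∗ w ⦆∗ u ⟩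
  ∗∗-rotate Φ []      v       w       = trans (+-identityʳ _) (sym (∑-cong (qsh v w) (∗-identityʳ Φ)))
  ∗∗-rotate Φ (a ∷ u) []      w       = +-congʳ (∗-comm Φ (a ∷ u) w)
  ∗∗-rotate Φ (a ∷ u) (b ∷ v) []      =
    trans (∑-cong (qsh (a ∷ u) (b ∷ v)) (∗-identityʳ Φ))
          (trans (∗-comm Φ (a ∷ u) (b ∷ v)) (sym (+-identityʳ _)))
  ∗∗-rotate Φ (a ∷ u) (b ∷ v) (c ∷ w) = begin
    ⟨ Φ ∣⦅ a ∷ u ∗ b ∷ v ⦆∗ c ∷ w ⟩
      ≈⟨ ∗∗-∷ Φ a u b v c w ⟩
    L₁ + (L₂ + (L₃ + (L₄ + (L₅ + (L₆ + L₇)))))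
      ≈⟨ +-cong (∗∗-rotate _ u (b ∷ v) (c ∷ w)) (+-cong (∗∗-rotate _ (a ∷ u) v (c ∷ w))
           (+-cong (∗∗-rotate _ (a ∷ u) (b ∷ v) w) (+-cong
             (trans (δ-cong a b (∗∗-rotate _ u v (c ∷ w))) (δ-comm a b (λ n → ⟨ ∂ n Φ ∣⦅ v ∗ c ∷ w ⦆∗ u ⟩)))
           (+-cong (trans (δ-cong a c (∗∗-rotate _ u (b ∷ v) w)) (δ-comm a c (λ n → ⟨ ∂ n Φ ∣⦅ b ∷ v ∗ w ⦆∗ u ⟩)))
           (+-cong (δ-cong b c (∗∗-rotate _ (a ∷ u) v w))
             (trans (δ-cong a b (δ-cong (a +ℕ b) c (∗∗-rotate _ u v w)))
                    (δ-rotate a b c (λ n → ⟨ ∂ n Φ ∣⦅ v ∗ w ⦆∗ u ⟩)))))))) ⟩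
    R₃ + (R₁ + (R₂ + (R₅ + (R₆ + (R₄ + R₇)))))
      ≈⟨ +-Solver.solve 7 (λ R₁ R₂ R₃ R₄ R₅ R₆ R₇ →
           R₃ ⊕ (R₁ ⊕ (R₂ ⊕ (R₅ ⊕ (R₆ ⊕ (R₄ ⊕ R₇))))) ⊜ R₁ ⊕ (R₂ ⊕ (R₃ ⊕ (R₄ ⊕ (R₅ ⊕ (R₆ ⊕ R₇))))))
           refl R₁ R₂ R₃ R₄ R₅ R₆ R₇ ⟩
    R₁ + (R₂ + (R₃ + (R₄ + (R₅ + (R₆ + R₇)))))
      ≈⟨ sym (∗∗-∷ Φ b v c w a u) ⟩
    ⟨ Φ ∣⦅ b ∷ v ∗ c ∷ w ⦆∗ a ∷ u ⟩ ∎
    where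
    L₁ = ⟨ ∂ a Φ ∣⦅ u ∗ b ∷ v ⦆∗ c ∷ w ⟩
    L₂ = ⟨ ∂ b Φ ∣⦅ a ∷ u ∗ v ⦆∗ c ∷ w ⟩
    L₃ = ⟨ ∂ c Φ ∣⦅ a ∷ u ∗ b ∷ v ⦆∗ w ⟩
    L₄ = δ a b ⟨ ∂ (a +ℕ b) Φ ∣⦅ u ∗ v ⦆∗ c ∷ w ⟩
    L₅ = δ a c ⟨ ∂ (a +ℕ c) Φ ∣⦅ u ∗ b ∷ v ⦆∗ w ⟩
    L₆ = δ b c ⟨ ∂ (b +ℕ c) Φ ∣⦅ a ∷ u ∗ v ⦆∗ w ⟩
    L₇ = δ a b (δ (a +ℕ b) c ⟨ ∂ ((a +ℕ b) +ℕ c) Φ ∣⦅ u ∗ v ⦆∗ w ⟩)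
    R₁ = ⟨ ∂ b Φ ∣⦅ v ∗ c ∷ w ⦆∗ a ∷ u ⟩
    R₂ = ⟨ ∂ c Φ ∣⦅ b ∷ v ∗ w ⦆∗ a ∷ u ⟩
    R₃ = ⟨ ∂ a Φ ∣⦅ b ∷ v ∗ c ∷ w ⦆∗ u ⟩
    R₄ = δ b c ⟨ ∂ (b +ℕ c) Φ ∣⦅ v ∗ w ⦆∗ a ∷ u ⟩
    R₅ = δ b a ⟨ ∂ (b +ℕ a) Φ ∣⦅ v ∗ c ∷ w ⦆∗ u ⟩
    R₆ = δ c a ⟨ ∂ (c +ℕ a) Φ ∣⦅ b ∷ v ∗ w ⦆∗ u ⟩
    R₇ = δ b c (δ (b +ℕ c) a ⟨ ∂ ((b +ℕ c) +ℕ a) Φ ∣⦅ v ∗ w ⦆∗ u ⟩)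

  ∗-assoc : ∀ Φ u v w → ⟨ Φ ∣⦅ u ∗ v ⦆∗ w ⟩ ≈ ⟨ Φ ∣ u ∗⦅ v ∗ w ⦆⟩
  ∗-assoc Φ u v w = trans (∗∗-rotate Φ u v w) (∑-cong (qsh v w) (λ x → ∗-comm Φ x u))

  ∑-splits-∷ : ∀ a w (G : Word × Word → Carrier) →
    ΣL (splits (a ∷ w)) G ≈ G ([] , a ∷ w) + ΣL (splits w) (λ q → G (a ∷ proj₁ q , proj₂ q))
  ∑-splits-∷ a w G = +-congˡ (∑-map _ (splits w) G)

  ∂-conc : ∀ a Φ Ψ → ∂ a (conc Φ Ψ) ≈S ((Φ [] ·S ∂ a Ψ) +S conc (∂ a Φ) Ψ)
  ∂-conc a Φ Ψ w = ∑-splits-∷ a w _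

  ∗-∂-conc : ∀ a Φ Ψ x y →
             ⟨ ∂ a (conc Φ Ψ) ∣ x ∗ y ⟩ ≈ Φ [] * ⟨ ∂ a Ψ ∣ x ∗ y ⟩ + ⟨ conc (∂ a Φ) Ψ ∣ x ∗ y ⟩
  ∗-∂-conc a Φ Ψ x y =
    trans (∑-cong (qsh x y) (∂-conc a Φ Ψ)) (trans (∑-+ (qsh x y) _ _) (+-congʳ (∑-*ˡ (qsh x y) (Φ []) _)))

  decPairing : Ser → Ser → Word → Word → Carrier
  decPairing Φ Ψ u v =
    ΣL (splits u) (λ p → ΣL (splits v) (λ q → ⟨ Φ ∣ proj₁ p ∗ proj₁ q ⟩ * ⟨ Ψ ∣ proj₂ p ∗ proj₂ q ⟩))

  decPairing-∷ : ∀ Φ Ψ a u b v → decPairing Φ Ψ (a ∷ u) (b ∷ v) ≈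
    Φ [] * ⟨ Ψ ∣ a ∷ u ∗ b ∷ v ⟩ +
      (decPairing (∂ a Φ) Ψ u (b ∷ v) + (decPairing (∂ b Φ) Ψ (a ∷ u) v + δ a b (decPairing (∂ (a +ℕ b) Φ) Ψ u v)))
  decPairing-∷ Φ Ψ a u b v = begin
    decPairing Φ Ψ (a ∷ u) (b ∷ v)
      ≈⟨ ∑-splits-∷ a u _ ⟩
    ΣL (splits (b ∷ v)) (λ q → ⟨ Φ ∣ [] ∗ proj₁ q ⟩ * ⟨ Ψ ∣ a ∷ u ∗ proj₂ q ⟩) +
      ΣL (splits u) (λ p → ΣL (splits (b ∷ v)) (λ q → ⟨ Φ ∣ a ∷ proj₁ p ∗ proj₁ q ⟩ * ⟨ Ψ ∣ proj₂ p ∗ proj₂ q ⟩))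
      ≈⟨ +-cong emptyLeft (trans (∑-cong (splits u) nonemptyLeft) (trans (∑-+ (splits u) _ _) (+-congˡ
           (trans (∑-+ (splits u) _ _) (+-congˡ (∑-δ a b (splits u) _)))))) ⟩
    (Φ [] * ⟨ Ψ ∣ a ∷ u ∗ b ∷ v ⟩ + X) + (A₁ + (A₂ + δ a b A₃))
      ≈⟨ +-Solver.solve 5 (λ F X A₁ A₂ A₃ → (F ⊕ X) ⊕ (A₁ ⊕ (A₂ ⊕ A₃)) ⊜ F ⊕ (A₁ ⊕ ((X ⊕ A₂) ⊕ A₃)))
           refl (Φ [] * ⟨ Ψ ∣ a ∷ u ∗ b ∷ v ⟩) X A₁ A₂ (δ a b A₃) ⟩
    Φ [] * ⟨ Ψ ∣ a ∷ u ∗ b ∷ v ⟩ + (A₁ + ((X + A₂) + δ a b A₃))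
      ≈⟨ +-congˡ (+-cong (sym (∑-cong (splits u) (λ p →
               trans (∑-splits-∷ b v _) (+-congʳ (*-congʳ (∗-identityʳ (∂ a Φ) (proj₁ p)))))))
           (+-congʳ (sym (trans (∑-splits-∷ a u _)
               (+-congʳ (∑-cong (splits v) (λ q → *-congʳ (∗-identityˡ (∂ b Φ) _)))))))) ⟩
    Φ [] * ⟨ Ψ ∣ a ∷ u ∗ b ∷ v ⟩ +
      (decPairing (∂ a Φ) Ψ u (b ∷ v) + (decPairing (∂ b Φ) Ψ (a ∷ u) v + δ a b (decPairing (∂ (a +ℕ b) Φ) Ψ u v))) ∎
    where
    X  = ΣL (splits v) (λ q → Φ (b ∷ proj₁ q) * ⟨ Ψ ∣ a ∷ u ∗ proj₂ q ⟩)
    A₁ = ΣL (splits u) (λ p → Φ (a ∷ proj₁ p) * ⟨ Ψ ∣ proj₂ p ∗ b ∷ v ⟩ +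
                              ΣL (splits v) (λ q → ⟨ ∂ a Φ ∣ proj₁ p ∗ b ∷ proj₁ q ⟩ * ⟨ Ψ ∣ proj₂ p ∗ proj₂ q ⟩))
    A₂ = ΣL (splits u) (λ p → ΣL (splits v) (λ q → ⟨ ∂ b Φ ∣ a ∷ proj₁ p ∗ proj₁ q ⟩ * ⟨ Ψ ∣ proj₂ p ∗ proj₂ q ⟩))
    A₃ = ΣL (splits u) (λ p → ΣL (splits v) (λ q → ⟨ ∂ (a +ℕ b) Φ ∣ proj₁ p ∗ proj₁ q ⟩ * ⟨ Ψ ∣ proj₂ p ∗ proj₂ q ⟩))

    emptyLeft : ΣL (splits (b ∷ v)) (λ q → ⟨ Φ ∣ [] ∗ proj₁ q ⟩ * ⟨ Ψ ∣ a ∷ u ∗ proj₂ q ⟩) ≈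
                Φ [] * ⟨ Ψ ∣ a ∷ u ∗ b ∷ v ⟩ + X
    emptyLeft = trans (∑-splits-∷ b v _)
      (+-cong (*-congʳ (∗-identityˡ Φ [])) (∑-cong (splits v) (λ q → *-congʳ (∗-identityˡ Φ _))))

    nonemptyLeft : ∀ p →
      ΣL (splits (b ∷ v)) (λ q → ⟨ Φ ∣ a ∷ proj₁ p ∗ proj₁ q ⟩ * ⟨ Ψ ∣ proj₂ p ∗ proj₂ q ⟩) ≈
      (Φ (a ∷ proj₁ p) * ⟨ Ψ ∣ proj₂ p ∗ b ∷ v ⟩ +
         ΣL (splits v) (λ q → ⟨ ∂ a Φ ∣ proj₁ p ∗ b ∷ proj₁ q ⟩ * ⟨ Ψ ∣ proj₂ p ∗ proj₂ q ⟩)) +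
      (ΣL (splits v) (λ q → ⟨ ∂ b Φ ∣ a ∷ proj₁ p ∗ proj₁ q ⟩ * ⟨ Ψ ∣ proj₂ p ∗ proj₂ q ⟩) +
       δ a b (ΣL (splits v) (λ q → ⟨ ∂ (a +ℕ b) Φ ∣ proj₁ p ∗ proj₁ q ⟩ * ⟨ Ψ ∣ proj₂ p ∗ proj₂ q ⟩)))
    nonemptyLeft (x , y) = begin
      ΣL (splits (b ∷ v)) (λ q → ⟨ Φ ∣ a ∷ x ∗ proj₁ q ⟩ * ⟨ Ψ ∣ y ∗ proj₂ q ⟩)
        ≈⟨ ∑-splits-∷ b v _ ⟩
      ⟨ Φ ∣ a ∷ x ∗ [] ⟩ * ⟨ Ψ ∣ y ∗ b ∷ v ⟩ +
        ΣL (splits v) (λ q → ⟨ Φ ∣ a ∷ x ∗ b ∷ proj₁ q ⟩ * ⟨ Ψ ∣ y ∗ proj₂ q ⟩)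
        ≈⟨ +-cong (*-congʳ (∗-identityʳ Φ (a ∷ x))) (∑-cong (splits v) (λ q →
             trans (*-congʳ (∗-∷ Φ a x b (proj₁ q)))
                   (trans (distribʳ _ _ _) (+-congˡ (trans (distribʳ _ _ _) (+-congˡ (sym (δ-*ʳ a b _ _)))))))) ⟩
      Φ (a ∷ x) * ⟨ Ψ ∣ y ∗ b ∷ v ⟩ +
        ΣL (splits v) (λ q → ⟨ ∂ a Φ ∣ x ∗ b ∷ proj₁ q ⟩ * ⟨ Ψ ∣ y ∗ proj₂ q ⟩ +
          (⟨ ∂ b Φ ∣ a ∷ x ∗ proj₁ q ⟩ * ⟨ Ψ ∣ y ∗ proj₂ q ⟩ +
           δ a b (⟨ ∂ (a +ℕ b) Φ ∣ x ∗ proj₁ q ⟩ * ⟨ Ψ ∣ y ∗ proj₂ q ⟩)))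
        ≈⟨ +-congˡ (trans (∑-+ (splits v) _ _) (+-congˡ (trans (∑-+ (splits v) _ _) (+-congˡ (∑-δ a b (splits v) _))))) ⟩
      Φ (a ∷ x) * ⟨ Ψ ∣ y ∗ b ∷ v ⟩ +
        (ΣL (splits v) (λ q → ⟨ ∂ a Φ ∣ x ∗ b ∷ proj₁ q ⟩ * ⟨ Ψ ∣ y ∗ proj₂ q ⟩) +
          (ΣL (splits v) (λ q → ⟨ ∂ b Φ ∣ a ∷ x ∗ proj₁ q ⟩ * ⟨ Ψ ∣ y ∗ proj₂ q ⟩) +
           δ a b (ΣL (splits v) (λ q → ⟨ ∂ (a +ℕ b) Φ ∣ x ∗ proj₁ q ⟩ * ⟨ Ψ ∣ y ∗ proj₂ q ⟩))))
        ≈⟨ sym (+-assoc _ _ _) ⟩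
      _ ∎

  ∗-conc : ∀ Φ Ψ u v → ⟨ conc Φ Ψ ∣ u ∗ v ⟩ ≈ decPairing Φ Ψ u v
  ∗-conc Φ Ψ []      v       =
    +-congʳ (∑-cong (splits v) (λ q → sym (*-cong (∗-identityˡ Φ _) (∗-identityˡ Ψ _))))
  ∗-conc Φ Ψ (a ∷ u) []      = trans (+-identityʳ _) (sym (∑-cong (splits (a ∷ u)) (λ p →
    trans (+-identityʳ _) (*-cong (∗-identityʳ Φ _) (∗-identityʳ Ψ _)))))
  ∗-conc Φ Ψ (a ∷ u) (b ∷ v) = begin
    ⟨ conc Φ Ψ ∣ a ∷ u ∗ b ∷ v ⟩
      ≈⟨ ∗-∷ (conc Φ Ψ) a u b v ⟩
    ⟨ ∂ a (conc Φ Ψ) ∣ u ∗ b ∷ v ⟩ +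
      (⟨ ∂ b (conc Φ Ψ) ∣ a ∷ u ∗ v ⟩ + δ a b ⟨ ∂ (a +ℕ b) (conc Φ Ψ) ∣ u ∗ v ⟩)
      ≈⟨ +-cong (trans (∗-∂-conc a Φ Ψ u (b ∷ v)) (+-congˡ (∗-conc (∂ a Φ) Ψ u (b ∷ v))))
           (+-cong (trans (∗-∂-conc b Φ Ψ (a ∷ u) v) (+-congˡ (∗-conc (∂ b Φ) Ψ (a ∷ u) v)))
             (trans (δ-cong a b (∗-∂-conc (a +ℕ b) Φ Ψ u v))
               (trans (δ-+ a b _ _) (+-cong (δ-*ˡ a b (Φ []) _) (δ-cong a b (∗-conc (∂ (a +ℕ b) Φ) Ψ u v)))))) ⟩
    (Φ [] * F₁ + H₁) + ((Φ [] * F₂ + H₂) + (Φ [] * δ a b F₃ + δ a b H₃))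
      ≈⟨ +-Solver.solve 6 (λ x₁ h₁ x₂ h₂ x₃ h₃ →
           (x₁ ⊕ h₁) ⊕ ((x₂ ⊕ h₂) ⊕ (x₃ ⊕ h₃)) ⊜ (x₁ ⊕ (x₂ ⊕ x₃)) ⊕ (h₁ ⊕ (h₂ ⊕ h₃)))
           refl (Φ [] * F₁) H₁ (Φ [] * F₂) H₂ (Φ [] * δ a b F₃) (δ a b H₃) ⟩
    (Φ [] * F₁ + (Φ [] * F₂ + Φ [] * δ a b F₃)) + (H₁ + (H₂ + δ a b H₃))
      ≈⟨ +-congʳ (trans (+-congˡ (sym (distribˡ (Φ []) _ _)))
                        (trans (sym (distribˡ (Φ []) _ _)) (*-congˡ (sym (∗-∷ Ψ a u b v))))) ⟩
    Φ [] * ⟨ Ψ ∣ a ∷ u ∗ b ∷ v ⟩ + (H₁ + (H₂ + δ a b H₃))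
      ≈⟨ sym (decPairing-∷ Φ Ψ a u b v) ⟩
    decPairing Φ Ψ (a ∷ u) (b ∷ v) ∎
    where
    F₁ = ⟨ ∂ a Ψ ∣ u ∗ b ∷ v ⟩
    F₂ = ⟨ ∂ b Ψ ∣ a ∷ u ∗ v ⟩
    F₃ = ⟨ ∂ (a +ℕ b) Ψ ∣ u ∗ v ⟩
    H₁ = decPairing (∂ a Φ) Ψ u (b ∷ v)
    H₂ = decPairing (∂ b Φ) Ψ (a ∷ u) v
    H₃ = decPairing (∂ (a +ℕ b) Φ) Ψ u v

  ∗-oneS : ∀ u v → ⟨ oneS ∣ u ∗ v ⟩ ≈ oneS u * oneS v
  ∗-oneS []      v       = trans (+-identityʳ _) (sym (*-identityˡ _))
  ∗-oneS (a ∷ u) []      = trans (+-identityʳ _) (sym (zeroˡ _))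
  ∗-oneS (a ∷ u) (b ∷ v) = begin
    ⟨ oneS ∣ a ∷ u ∗ b ∷ v ⟩
      ≈⟨ ∗-∷ oneS a u b v ⟩
    ⟨ ∂ a oneS ∣ u ∗ b ∷ v ⟩ + (⟨ ∂ b oneS ∣ a ∷ u ∗ v ⟩ + δ a b ⟨ ∂ (a +ℕ b) oneS ∣ u ∗ v ⟩)
      ≈⟨ +-cong (∑-0 (qsh u (b ∷ v)))
                (+-cong (∑-0 (qsh (a ∷ u) v)) (trans (δ-cong a b (∑-0 (qsh u v))) (δ-0 a b))) ⟩
    0# + (0# + 0#)
      ≈⟨ trans (+-identityˡ _) (+-identityˡ 0#) ⟩
    0#
      ≈⟨ sym (zeroˡ _) ⟩
    0# * oneS (b ∷ v) ∎

  ∑-splits-coassoc : ∀ w (K : Word → Word → Word → Carrier) →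
    ΣL (splits w) (λ p → ΣL (splits (proj₁ p)) (λ q → K (proj₁ q) (proj₂ q) (proj₂ p))) ≈
    ΣL (splits w) (λ p → ΣL (splits (proj₂ p)) (λ q → K (proj₁ p) (proj₁ q) (proj₂ q)))
  ∑-splits-coassoc []      K = refl
  ∑-splits-coassoc (a ∷ w) K = begin
    ΣL (splits (a ∷ w)) (λ p → ΣL (splits (proj₁ p)) (λ q → K (proj₁ q) (proj₂ q) (proj₂ p)))
      ≈⟨ ∑-splits-∷ a w _ ⟩
    (K [] [] (a ∷ w) + 0#) +
      ΣL (splits w) (λ p → ΣL (splits (a ∷ proj₁ p)) (λ q → K (proj₁ q) (proj₂ q) (proj₂ p)))
      ≈⟨ +-cong (+-identityʳ _)
                (trans (∑-cong (splits w) (λ p → ∑-splits-∷ a (proj₁ p) _)) (∑-+ (splits w) _ _)) ⟩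
    K [] [] (a ∷ w) + (ΣL (splits w) (λ p → K [] (a ∷ proj₁ p) (proj₂ p)) +
       ΣL (splits w) (λ p → ΣL (splits (proj₁ p)) (λ q → K (a ∷ proj₁ q) (proj₂ q) (proj₂ p))))
      ≈⟨ trans (+-congˡ (+-congˡ (∑-splits-coassoc w (λ x → K (a ∷ x))))) (sym (+-assoc _ _ _)) ⟩
    (K [] [] (a ∷ w) + ΣL (splits w) (λ p → K [] (a ∷ proj₁ p) (proj₂ p))) +
       ΣL (splits w) (λ p → ΣL (splits (proj₂ p)) (λ q → K (a ∷ proj₁ p) (proj₁ q) (proj₂ q)))
      ≈⟨ trans (+-congʳ (sym (∑-splits-∷ a w (λ q → K [] (proj₁ q) (proj₂ q))))) (sym (∑-splits-∷ a w _)) ⟩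
    ΣL (splits (a ∷ w)) (λ p → ΣL (splits (proj₂ p)) (λ q → K (proj₁ p) (proj₁ q) (proj₂ q))) ∎

  conc-assoc : ∀ Φ Ψ Χ → conc (conc Φ Ψ) Χ ≈S conc Φ (conc Ψ Χ)
  conc-assoc Φ Ψ Χ w = begin
    ΣL (splits w) (λ p → ΣL (splits (proj₁ p)) (λ q → Φ (proj₁ q) * Ψ (proj₂ q)) * Χ (proj₂ p))
      ≈⟨ ∑-cong (splits w) (λ p → sym (∑-*ʳ (splits (proj₁ p)) _ _)) ⟩
    ΣL (splits w) (λ p → ΣL (splits (proj₁ p)) (λ q → (Φ (proj₁ q) * Ψ (proj₂ q)) * Χ (proj₂ p)))
      ≈⟨ ∑-splits-coassoc w (λ x y z → (Φ x * Ψ y) * Χ z) ⟩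
    ΣL (splits w) (λ p → ΣL (splits (proj₂ p)) (λ q → (Φ (proj₁ p) * Ψ (proj₁ q)) * Χ (proj₂ q)))
      ≈⟨ ∑-cong (splits w) (λ p →
           trans (∑-cong (splits (proj₂ p)) (λ q → *-assoc _ _ _)) (∑-*ˡ (splits (proj₂ p)) _ _)) ⟩
    ΣL (splits w) (λ p → Φ (proj₁ p) * ΣL (splits (proj₂ p)) (λ q → Ψ (proj₁ q) * Χ (proj₂ q))) ∎

  ∑-splits-oneSʳ : ∀ w (G : Ser) → ΣL (splits w) (λ p → G (proj₁ p) * oneS (proj₂ p)) ≈ G w
  ∑-splits-oneSʳ []      G = trans (+-identityʳ _) (*-identityʳ _)
  ∑-splits-oneSʳ (a ∷ w) G =
    trans (∑-splits-∷ a w _) (trans (+-cong (zeroʳ _) (∑-splits-oneSʳ w (∂ a G))) (+-identityˡ _))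

  ∑-splits-oneSˡ : ∀ w (G : Ser) → ΣL (splits w) (λ p → oneS (proj₁ p) * G (proj₂ p)) ≈ G w
  ∑-splits-oneSˡ []      G = trans (+-identityʳ _) (*-identityˡ _)
  ∑-splits-oneSˡ (a ∷ w) G = trans (∑-splits-∷ a w _)
    (trans (+-cong (*-identityˡ _) (trans (∑-cong (splits w) (λ q → zeroˡ _)) (∑-0 (splits w)))) (+-identityʳ _))

  record IsLinear (f : Ser → Ser) : Set (c ⊔ ℓ) where
    field
      resp     : ∀ {Φ Ψ} → Φ ≈S Ψ → f Φ ≈S f Ψ
      additive : ∀ Φ Ψ → f (Φ +S Ψ) ≈S (f Φ +S f Ψ)
      homogen  : ∀ r Φ → f (r ·S Φ) ≈S (r ·S f Φ)

    map-0 : ∀ w → f (λ _ → 0#) w ≈ 0#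
    map-0 w = begin
      f (λ _ → 0#) w          ≈⟨ resp {Ψ = 0# ·S (λ _ → 0#)} (λ _ → sym (zeroˡ 0#)) w ⟩
      f (0# ·S (λ _ → 0#)) w  ≈⟨ homogen 0# _ w ⟩
      0# * f (λ _ → 0#) w     ≈⟨ zeroˡ _ ⟩
      0#                      ∎

    map-∑ : ∀ {A : Set} (L : List A) (G : A → Ser) w →
            f (λ x → ΣL L (λ l → G l x)) w ≈ ΣL L (λ l → f (G l) w)
    map-∑ []      G w = map-0 w
    map-∑ (l ∷ L) G w = trans (additive (G l) _ w) (+-congˡ (map-∑ L G w))

  open IsLinear

  id-isLinear : IsLinear id
  id-isLinear = record { resp = λ Φ≈Ψ → Φ≈Ψ ; additive = λ _ _ _ → refl ; homogen = λ _ _ _ → refl }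

  -- Convolution and the antipode

  -- The convolution conc ∘ (f ⊗ g) ∘ Δb, with Δb read off through Δb≈∑qsh.
  _⋆_ : (Ser → Ser) → (Ser → Ser) → (Ser → Ser)
  (f ⋆ g) Φ w = ΣL (splits w) (λ p → f (λ x → g (λ y → ⟨ Φ ∣ x ∗ y ⟩) (proj₂ p)) (proj₁ p))

  ⋆-identityʳ : ∀ {f} → IsLinear f → ∀ Φ → (f ⋆ ηε) Φ ≈S f Φ
  ⋆-identityʳ {f} f-lin Φ w = begin
    ΣL (splits w) (λ p → f (λ x → ⟨ Φ ∣ x ∗ [] ⟩ * oneS (proj₂ p)) (proj₁ p))
      ≈⟨ ∑-cong (splits w) (λ p →
           resp f-lin (λ x → trans (*-congʳ (∗-identityʳ Φ x)) (*-comm _ _)) (proj₁ p)) ⟩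
    ΣL (splits w) (λ p → f (oneS (proj₂ p) ·S Φ) (proj₁ p))
      ≈⟨ ∑-cong (splits w) (λ p → trans (homogen f-lin (oneS (proj₂ p)) Φ (proj₁ p)) (*-comm _ _)) ⟩
    ΣL (splits w) (λ p → f Φ (proj₁ p) * oneS (proj₂ p))
      ≈⟨ ∑-splits-oneSʳ w (f Φ) ⟩
    f Φ w ∎

  ⋆-identityˡ : ∀ {g} → IsLinear g → ∀ Φ → (ηε ⋆ g) Φ ≈S g Φ
  ⋆-identityˡ {g} g-lin Φ w = trans
    (∑-cong (splits w) (λ p → trans (*-congʳ (resp g-lin (∗-identityˡ Φ) (proj₂ p))) (*-comm _ _)))
    (∑-splits-oneSˡ w (g Φ))

  ⋆-congʳ : ∀ {f g g′} → IsLinear f → (∀ Φ → g Φ ≈S g′ Φ) → ∀ Φ → (f ⋆ g) Φ ≈S (f ⋆ g′) Φ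
  ⋆-congʳ f-lin g≈g′ Φ w = ∑-cong (splits w) (λ p → resp f-lin (λ x → g≈g′ _ (proj₂ p)) (proj₁ p))

  ⋆-congˡ : ∀ {f f′ g} → (∀ Φ → f Φ ≈S f′ Φ) → ∀ Φ → (f ⋆ g) Φ ≈S (f′ ⋆ g) Φ
  ⋆-congˡ f≈f′ Φ w = ∑-cong (splits w) (λ p → f≈f′ _ (proj₁ p))

  ⋆-assoc : ∀ {f g h} → IsLinear f → IsLinear g → IsLinear h →
            ∀ Φ → ((f ⋆ g) ⋆ h) Φ ≈S (f ⋆ (g ⋆ h)) Φ
  ⋆-assoc {f} {g} {h} f-lin g-lin h-lin Φ w = begin
    ((f ⋆ g) ⋆ h) Φ w
      ≈⟨ ∑-cong (splits w) (λ p → ∑-cong (splits (proj₁ p)) (λ q → resp f-lin (λ x → resp g-lin (λ y →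
            sym (map-∑ h-lin (qsh x y) (λ z t → ⟨ Φ ∣ z ∗ t ⟩) (proj₂ p))) (proj₂ q)) (proj₁ q))) ⟩
    ΣL (splits w) (λ p → ΣL (splits (proj₁ p)) (λ q → K (proj₁ q) (proj₂ q) (proj₂ p)))
      ≈⟨ ∑-splits-coassoc w K ⟩
    ΣL (splits w) (λ p → ΣL (splits (proj₂ p)) (λ q → K (proj₁ p) (proj₁ q) (proj₂ q)))
      ≈⟨ ∑-cong (splits w) (λ p → ∑-cong (splits (proj₂ p)) (λ q → resp f-lin (λ x → resp g-lin (λ y →
            resp h-lin (λ z → ∗-assoc Φ x y z) (proj₂ q)) (proj₁ q)) (proj₁ p))) ⟩
    ΣL (splits w) (λ p → ΣL (splits (proj₂ p)) (λ q → f (λ x → K′ x (proj₁ q) (proj₂ q)) (proj₁ p)))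
      ≈⟨ ∑-cong (splits w) (λ p → sym (map-∑ f-lin (splits (proj₂ p)) (λ q x → K′ x (proj₁ q) (proj₂ q)) (proj₁ p))) ⟩
    (f ⋆ (g ⋆ h)) Φ w ∎
    where
    K K′ : Word → Word → Word → Carrier
    K x y z = f (λ x′ → g (λ y′ → h (λ z′ → ⟨ Φ ∣⦅ x′ ∗ y′ ⦆∗ z′ ⟩) z) y) x
    K′ x y z = g (λ y′ → h (λ z′ → ⟨ Φ ∣ x ∗⦅ y′ ∗ z′ ⦆⟩) z) y

  -- antipodeAfter pre w Ψ stands for Σ_{w = x y} antipode ⟨ Ψ ∣ pre ++ x ∗ - ⟩ y (antipodeAfter-spec);
  -- in this form the recursion defining the antipode is structural.
  mutual
    antipode : Ser → Ser
    antipode Ψ []      = Ψ []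
    antipode Ψ (a ∷ w) = - antipodeAfter (a ∷ []) w Ψ

    antipodeAfter : Word → Word → Ser → Carrier
    antipodeAfter pre []      Ψ = ⟨ Ψ ∣ pre ∗ [] ⟩ + 0#
    antipodeAfter pre (b ∷ w) Ψ =
      - antipodeAfter (b ∷ []) w (λ y → ⟨ Ψ ∣ pre ∗ y ⟩) + antipodeAfter (pre ++ b ∷ []) w Ψ

  mutual
    antipode-resp : ∀ {Φ Ψ} → Φ ≈S Ψ → antipode Φ ≈S antipode Ψ
    antipode-resp Φ≈Ψ []      = Φ≈Ψ []
    antipode-resp Φ≈Ψ (a ∷ w) = -‿cong (antipodeAfter-resp (a ∷ []) w Φ≈Ψ)

    antipodeAfter-resp : ∀ pre w {Φ Ψ} → Φ ≈S Ψ → antipodeAfter pre w Φ ≈ antipodeAfter pre w Ψ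
    antipodeAfter-resp pre []      Φ≈Ψ = +-congʳ (∑-cong (qsh pre []) Φ≈Ψ)
    antipodeAfter-resp pre (b ∷ w) Φ≈Ψ =
      +-cong (-‿cong (antipodeAfter-resp (b ∷ []) w (λ y → ∑-cong (qsh pre y) Φ≈Ψ)))
             (antipodeAfter-resp (pre ++ b ∷ []) w Φ≈Ψ)

  mutual
    antipode-additive : ∀ Φ Ψ → antipode (Φ +S Ψ) ≈S (antipode Φ +S antipode Ψ)
    antipode-additive Φ Ψ []      = refl
    antipode-additive Φ Ψ (a ∷ w) = trans (-‿cong (antipodeAfter-additive (a ∷ []) w Φ Ψ)) (sym (-‿+-comm _ _))

    antipodeAfter-additive : ∀ pre w Φ Ψ →
                             antipodeAfter pre w (Φ +S Ψ) ≈ antipodeAfter pre w Φ + antipodeAfter pre w Ψ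
    antipodeAfter-additive pre []      Φ Ψ =
      trans (+-identityʳ _) (trans (∑-+ (qsh pre []) Φ Ψ) (sym (+-cong (+-identityʳ _) (+-identityʳ _))))
    antipodeAfter-additive pre (b ∷ w) Φ Ψ = begin
      - antipodeAfter (b ∷ []) w (λ y → ⟨ Φ +S Ψ ∣ pre ∗ y ⟩) + antipodeAfter (pre ++ b ∷ []) w (Φ +S Ψ)
        ≈⟨ +-cong (-‿cong (trans (antipodeAfter-resp (b ∷ []) w (λ y → ∑-+ (qsh pre y) Φ Ψ))
                                 (antipodeAfter-additive (b ∷ []) w _ _)))
                  (antipodeAfter-additive (pre ++ b ∷ []) w Φ Ψ) ⟩
      - (Uᵩ + Uᵩ′) + (Vᵩ + Vᵩ′)
        ≈⟨ +-congʳ (sym (-‿+-comm Uᵩ Uᵩ′)) ⟩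
      (- Uᵩ + - Uᵩ′) + (Vᵩ + Vᵩ′)
        ≈⟨ interchange (- Uᵩ) (- Uᵩ′) Vᵩ Vᵩ′ ⟩
      (- Uᵩ + Vᵩ) + (- Uᵩ′ + Vᵩ′) ∎
      where
      Uᵩ  = antipodeAfter (b ∷ []) w (λ y → ⟨ Φ ∣ pre ∗ y ⟩)
      Uᵩ′ = antipodeAfter (b ∷ []) w (λ y → ⟨ Ψ ∣ pre ∗ y ⟩)
      Vᵩ  = antipodeAfter (pre ++ b ∷ []) w Φ
      Vᵩ′ = antipodeAfter (pre ++ b ∷ []) w Ψ

  mutual
    antipode-homogen : ∀ r Φ → antipode (r ·S Φ) ≈S (r ·S antipode Φ)
    antipode-homogen r Φ []      = refl
    antipode-homogen r Φ (a ∷ w) = trans (-‿cong (antipodeAfter-homogen r (a ∷ []) w Φ)) (-‿distribʳ-* _ _)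

    antipodeAfter-homogen : ∀ r pre w Φ → antipodeAfter pre w (r ·S Φ) ≈ r * antipodeAfter pre w Φ
    antipodeAfter-homogen r pre []      Φ =
      trans (+-identityʳ _) (trans (∑-*ˡ (qsh pre []) r Φ) (*-congˡ (sym (+-identityʳ _))))
    antipodeAfter-homogen r pre (b ∷ w) Φ = begin
      - antipodeAfter (b ∷ []) w (λ y → ⟨ r ·S Φ ∣ pre ∗ y ⟩) + antipodeAfter (pre ++ b ∷ []) w (r ·S Φ)
        ≈⟨ +-cong (-‿cong (trans (antipodeAfter-resp (b ∷ []) w (λ y → ∑-*ˡ (qsh pre y) r Φ))
                                 (antipodeAfter-homogen r (b ∷ []) w _)))
                  (antipodeAfter-homogen r (pre ++ b ∷ []) w Φ) ⟩
      - (r * antipodeAfter (b ∷ []) w (λ y → ⟨ Φ ∣ pre ∗ y ⟩)) + r * antipodeAfter (pre ++ b ∷ []) w Φ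
        ≈⟨ trans (+-congʳ (-‿distribʳ-* _ _)) (sym (distribˡ r _ _)) ⟩
      r * (- antipodeAfter (b ∷ []) w (λ y → ⟨ Φ ∣ pre ∗ y ⟩) + antipodeAfter (pre ++ b ∷ []) w Φ) ∎

  antipode-isLinear : IsLinear antipode
  antipode-isLinear = record { resp = antipode-resp ; additive = antipode-additive ; homogen = antipode-homogen }

  antipodeAfter-spec : ∀ pre w Ψ →
    antipodeAfter pre w Ψ ≈ ΣL (splits w) (λ p → antipode (λ y → ⟨ Ψ ∣ pre ++ proj₁ p ∗ y ⟩) (proj₂ p))
  antipodeAfter-spec pre []      Ψ =
    reflexive (≡.cong (λ x → ⟨ Ψ ∣ x ∗ [] ⟩ + 0#) (≡.sym (LP.++-identityʳ pre)))
  antipodeAfter-spec pre (b ∷ w) Ψ = begin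
    - antipodeAfter (b ∷ []) w (λ y → ⟨ Ψ ∣ pre ∗ y ⟩) + antipodeAfter (pre ++ b ∷ []) w Ψ
      ≈⟨ +-cong (-‿cong (antipodeAfter-resp (b ∷ []) w (λ y →
                  reflexive (≡.cong (λ x → ⟨ Ψ ∣ x ∗ y ⟩) (≡.sym (LP.++-identityʳ pre))))))
           (trans (antipodeAfter-spec (pre ++ b ∷ []) w Ψ) (∑-cong (splits w) (λ q →
              reflexive (≡.cong (λ x → antipode (λ y → ⟨ Ψ ∣ x ∗ y ⟩) (proj₂ q))
                                (LP.++-assoc pre (b ∷ []) (proj₁ q)))))) ⟩
    antipode (λ y → ⟨ Ψ ∣ pre ++ [] ∗ y ⟩) (b ∷ w) +
      ΣL (splits w) (λ q → antipode (λ y → ⟨ Ψ ∣ pre ++ b ∷ proj₁ q ∗ y ⟩) (proj₂ q))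
      ≈⟨ sym (∑-splits-∷ b w _) ⟩
    ΣL (splits (b ∷ w)) (λ p → antipode (λ y → ⟨ Ψ ∣ pre ++ proj₁ p ∗ y ⟩) (proj₂ p)) ∎

  id⋆antipode : ∀ Φ → (id ⋆ antipode) Φ ≈S ηε Φ
  id⋆antipode Φ []      = trans (+-identityʳ _) (trans (+-identityʳ _) (sym (*-identityʳ _)))
  id⋆antipode Φ (a ∷ w) = begin
    (id ⋆ antipode) Φ (a ∷ w)
      ≈⟨ ∑-splits-∷ a w _ ⟩
    - antipodeAfter (a ∷ []) w (λ y → ⟨ Φ ∣ [] ∗ y ⟩) +
      ΣL (splits w) (λ q → antipode (λ y → ⟨ Φ ∣ a ∷ proj₁ q ∗ y ⟩) (proj₂ q))
      ≈⟨ +-cong (-‿cong (antipodeAfter-resp (a ∷ []) w (∗-identityˡ Φ))) (sym (antipodeAfter-spec (a ∷ []) w Φ)) ⟩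
    - antipodeAfter (a ∷ []) w Φ + antipodeAfter (a ∷ []) w Φ
      ≈⟨ -‿inverseˡ _ ⟩
    0#
      ≈⟨ sym (zeroʳ _) ⟩
    ηε Φ (a ∷ w) ∎

  mutual
    antipodeSupport : Word → List Word
    antipodeSupport []      = [] ∷ []
    antipodeSupport (a ∷ w) = antipodeAfterSupport (a ∷ []) w

    antipodeAfterSupport : Word → Word → List Word
    antipodeAfterSupport pre []      = qsh pre []
    antipodeAfterSupport pre (b ∷ w) =
      concatMap (qsh pre) (antipodeAfterSupport (b ∷ []) w) ++ antipodeAfterSupport (pre ++ b ∷ []) w

  mutual
    antipode-local : ∀ u Φ Ψ → All (λ w → Φ w ≈ Ψ w) (antipodeSupport u) → antipode Φ u ≈ antipode Ψ u
    antipode-local []      Φ Ψ (Φ≈Ψ ∷ _) = Φ≈Ψ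
    antipode-local (a ∷ w) Φ Ψ Φ≈Ψ       = -‿cong (antipodeAfter-local (a ∷ []) w Φ Ψ Φ≈Ψ)

    antipodeAfter-local : ∀ pre w Φ Ψ → All (λ x → Φ x ≈ Ψ x) (antipodeAfterSupport pre w) →
                          antipodeAfter pre w Φ ≈ antipodeAfter pre w Ψ
    antipodeAfter-local pre []      Φ Ψ Φ≈Ψ = +-congʳ (∑-cong-All Φ≈Ψ)
    antipodeAfter-local pre (b ∷ w) Φ Ψ Φ≈Ψ =
      +-cong (-‿cong (antipodeAfter-local (b ∷ []) w _ _
                (All.map ∑-cong-All (AllP.map⁻ (AllP.concat⁻ (AllP.++⁻ˡ (concatMap (qsh pre) S₁) Φ≈Ψ))))))
             (antipodeAfter-local (pre ++ b ∷ []) w Φ Ψ (AllP.++⁻ʳ (concatMap (qsh pre) S₁) Φ≈Ψ))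
      where S₁ = antipodeAfterSupport (b ∷ []) w

  properSplits : Word → List (Word × Word)
  properSplits []      = []
  properSplits (a ∷ w) = ([] , a ∷ w) ∷ map (λ q → (a ∷ proj₁ q , proj₂ q)) (properSplits w)

  ∑-splits-properSplits : ∀ w (G : Word × Word → Carrier) → ΣL (splits w) G ≈ ΣL (properSplits w) G + G (w , [])
  ∑-splits-properSplits []      G = trans (+-identityʳ _) (sym (+-identityˡ _))
  ∑-splits-properSplits (a ∷ w) G = begin
    ΣL (splits (a ∷ w)) G
      ≈⟨ ∑-splits-∷ a w G ⟩
    G ([] , a ∷ w) + ΣL (splits w) (λ q → G (a ∷ proj₁ q , proj₂ q))
      ≈⟨ +-congˡ (∑-splits-properSplits w _) ⟩
    G ([] , a ∷ w) + (ΣL (properSplits w) (λ q → G (a ∷ proj₁ q , proj₂ q)) + G (a ∷ w , []))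
      ≈⟨ trans (sym (+-assoc _ _ _)) (+-congʳ (+-congˡ (sym (∑-map _ (properSplits w) G)))) ⟩
    ΣL (properSplits (a ∷ w)) G + G (a ∷ w , []) ∎

  properSplits-shorter : ∀ w → All (λ p → suc (length (proj₁ p)) ≤ length w) (properSplits w)
  properSplits-shorter []      = []
  properSplits-shorter (a ∷ w) = s≤s z≤n ∷ AllP.map⁺ (All.map s≤s (properSplits-shorter w))

  -- The fuel makes the recursion on proper prefixes structural; with too little fuel the value is junk.
  leftAntipodeWithFuel : ℕ → Ser → Ser
  leftAntipodeWithFuel n       Φ []      = Φ []
  leftAntipodeWithFuel zero    Φ (a ∷ w) = 0#
  leftAntipodeWithFuel (suc n) Φ (a ∷ w) =
    - ΣL (properSplits (a ∷ w)) (λ p → leftAntipodeWithFuel n (λ x → ⟨ Φ ∣ x ∗ proj₂ p ⟩) (proj₁ p))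

  leftAntipode : Ser → Ser
  leftAntipode Φ w = leftAntipodeWithFuel (length w) Φ w

  leftAntipodeWithFuel-irrelevant : ∀ n m Φ x → length x ≤ n → length x ≤ m →
                                    leftAntipodeWithFuel n Φ x ≈ leftAntipodeWithFuel m Φ x
  leftAntipodeWithFuel-irrelevant n       m       Φ []      _         _         = refl
  leftAntipodeWithFuel-irrelevant (suc n) (suc m) Φ (a ∷ w) (s≤s w≤n) (s≤s w≤m) =
    -‿cong (∑-cong-All (All.map (λ {p} p<w → leftAntipodeWithFuel-irrelevant n m _ (proj₁ p)
                                    (ℕP.≤-trans (ℕP.≤-pred p<w) w≤n) (ℕP.≤-trans (ℕP.≤-pred p<w) w≤m))
                                 (properSplits-shorter (a ∷ w))))

  leftAntipodeWithFuel-isLinear : ∀ n → IsLinear (leftAntipodeWithFuel n)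
  leftAntipodeWithFuel-isLinear n = record { resp = resp′ n ; additive = additive′ n ; homogen = homogen′ n }
    where
    resp′ : ∀ n {Φ Ψ} → Φ ≈S Ψ → leftAntipodeWithFuel n Φ ≈S leftAntipodeWithFuel n Ψ
    resp′ n       Φ≈Ψ []      = Φ≈Ψ []
    resp′ zero    Φ≈Ψ (a ∷ w) = refl
    resp′ (suc n) Φ≈Ψ (a ∷ w) =
      -‿cong (∑-cong (properSplits (a ∷ w)) (λ p →
        resp′ n (λ x → ∑-cong (qsh x (proj₂ p)) Φ≈Ψ) (proj₁ p)))

    additive′ : ∀ n Φ Ψ →
                leftAntipodeWithFuel n (Φ +S Ψ) ≈S (leftAntipodeWithFuel n Φ +S leftAntipodeWithFuel n Ψ)
    additive′ n       Φ Ψ []      = refl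
    additive′ zero    Φ Ψ (a ∷ w) = sym (+-identityˡ 0#)
    additive′ (suc n) Φ Ψ (a ∷ w) =
      trans (-‿cong (trans (∑-cong (properSplits (a ∷ w)) (λ p →
               trans (resp′ n (λ x → ∑-+ (qsh x (proj₂ p)) Φ Ψ) (proj₁ p)) (additive′ n _ _ (proj₁ p))))
             (∑-+ (properSplits (a ∷ w)) _ _))) (sym (-‿+-comm _ _))

    homogen′ : ∀ n r Φ → leftAntipodeWithFuel n (r ·S Φ) ≈S (r ·S leftAntipodeWithFuel n Φ)
    homogen′ n       r Φ []      = refl
    homogen′ zero    r Φ (a ∷ w) = sym (zeroʳ r)
    homogen′ (suc n) r Φ (a ∷ w) =
      trans (-‿cong (trans (∑-cong (properSplits (a ∷ w)) (λ p →
               trans (resp′ n (λ x → ∑-*ˡ (qsh x (proj₂ p)) r Φ) (proj₁ p)) (homogen′ n r _ (proj₁ p))))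
             (∑-*ˡ (properSplits (a ∷ w)) r _))) (-‿distribʳ-* _ _)

  leftAntipode-isLinear : IsLinear leftAntipode
  leftAntipode-isLinear = record
    { resp     = λ Φ≈Ψ w → resp (leftAntipodeWithFuel-isLinear (length w)) Φ≈Ψ w
    ; additive = λ Φ Ψ w → additive (leftAntipodeWithFuel-isLinear (length w)) Φ Ψ w
    ; homogen  = λ r Φ w → homogen (leftAntipodeWithFuel-isLinear (length w)) r Φ w
    }

  leftAntipode⋆id : ∀ Φ → (leftAntipode ⋆ id) Φ ≈S ηε Φ
  leftAntipode⋆id Φ []      = trans (+-identityʳ _) (trans (+-identityʳ _) (sym (*-identityʳ _)))
  leftAntipode⋆id Φ (a ∷ w) = begin
    (leftAntipode ⋆ id) Φ (a ∷ w)
      ≈⟨ ∑-splits-properSplits (a ∷ w) _ ⟩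
    ΣL (properSplits (a ∷ w)) (λ p → leftAntipode (λ x → ⟨ Φ ∣ x ∗ proj₂ p ⟩) (proj₁ p)) +
      leftAntipode (λ x → ⟨ Φ ∣ x ∗ [] ⟩) (a ∷ w)
      ≈⟨ +-cong (∑-cong-All (All.map (λ {p} p<w →
                  leftAntipodeWithFuel-irrelevant _ (length w) _ (proj₁ p) ℕP.≤-refl (ℕP.≤-pred p<w))
                  (properSplits-shorter (a ∷ w))))
                (resp leftAntipode-isLinear (∗-identityʳ Φ) (a ∷ w)) ⟩
    ΣL (properSplits (a ∷ w)) (λ p → leftAntipodeWithFuel (length w) (λ x → ⟨ Φ ∣ x ∗ proj₂ p ⟩) (proj₁ p)) +
      leftAntipode Φ (a ∷ w)
      ≈⟨ trans (+-comm _ _) (-‿inverseˡ _) ⟩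
    0#
      ≈⟨ sym (zeroʳ _) ⟩
    ηε Φ (a ∷ w) ∎

  -- A left and a right convolution inverse of the identity coincide.
  leftAntipode≈antipode : ∀ Φ → leftAntipode Φ ≈S antipode Φ
  leftAntipode≈antipode Φ w = begin
    leftAntipode Φ w                   ≈⟨ sym (⋆-identityʳ leftAntipode-isLinear Φ w) ⟩
    (leftAntipode ⋆ ηε) Φ w            ≈⟨ ⋆-congʳ leftAntipode-isLinear (λ Ψ x → sym (id⋆antipode Ψ x)) Φ w ⟩
    (leftAntipode ⋆ (id ⋆ antipode)) Φ w
      ≈⟨ sym (⋆-assoc leftAntipode-isLinear id-isLinear antipode-isLinear Φ w) ⟩
    ((leftAntipode ⋆ id) ⋆ antipode) Φ w ≈⟨ ⋆-congˡ {g = antipode} leftAntipode⋆id Φ w ⟩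
    (ηε ⋆ antipode) Φ w                ≈⟨ ⋆-identityˡ antipode-isLinear Φ w ⟩
    antipode Φ w                       ∎

  antipode⋆id : ∀ Φ → (antipode ⋆ id) Φ ≈S ηε Φ
  antipode⋆id Φ w = trans (⋆-congˡ {g = id} (λ Ψ x → sym (leftAntipode≈antipode Ψ x)) Φ w) (leftAntipode⋆id Φ w)

  isHopf : IsCompleteCocommutativeHopf
  isHopf = record
    { conc-assoc = conc-assoc
    ; conc-unitˡ = λ Φ w → ∑-splits-oneSˡ w Φ
    ; conc-unitʳ = λ Φ w → ∑-splits-oneSʳ w Φ
    ; Δ-resp     = λ Φ Ψ Φ≈Ψ u v → viaPairing Φ u v Ψ u v (∑-cong (qsh u v) Φ≈Ψ)
    ; Δ-additive = λ Φ Ψ u v →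
        trans (Δb≈∑qsh _ u v) (trans (∑-+ (qsh u v) Φ Ψ) (sym (+-cong (Δb≈∑qsh Φ u v) (Δb≈∑qsh Ψ u v))))
    ; Δ-homogen  = λ r Φ u v →
        trans (Δb≈∑qsh _ u v) (trans (∑-*ˡ (qsh u v) r Φ) (*-congˡ (sym (Δb≈∑qsh Φ u v))))
    ; coassoc    = λ Φ u v w → begin
        Δb (λ x → Δb Φ x w) u v        ≈⟨ Δb≈∑qsh _ u v ⟩
        ΣL (qsh u v) (λ x → Δb Φ x w)  ≈⟨ ∑-cong (qsh u v) (λ x → Δb≈∑qsh Φ x w) ⟩
        ⟨ Φ ∣⦅ u ∗ v ⦆∗ w ⟩            ≈⟨ ∗-assoc Φ u v w ⟩
        ⟨ Φ ∣ u ∗⦅ v ∗ w ⦆⟩            ≈⟨ sym (∑-cong (qsh v w) (Δb≈∑qsh Φ u)) ⟩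
        ΣL (qsh v w) (Δb Φ u)          ≈⟨ sym (Δb≈∑qsh _ v w) ⟩
        Δb (Δb Φ u) v w                ∎
    ; counitˡ    = λ Φ v → trans (Δb≈∑qsh Φ [] v) (∗-identityˡ Φ v)
    ; counitʳ    = λ Φ u → trans (Δb≈∑qsh Φ u []) (∗-identityʳ Φ u)
    ; Δ-mult     = λ Φ Ψ u v → trans (Δb≈∑qsh _ u v) (trans (∗-conc Φ Ψ u v)
        (sym (∑-cong (splits u) (λ p → ∑-cong (splits v) (λ q →
           *-cong (Δb≈∑qsh Φ (proj₁ p) (proj₁ q)) (Δb≈∑qsh Ψ (proj₂ p) (proj₂ q)))))))
    ; Δ-unit     = λ u v → trans (Δb≈∑qsh oneS u v) (∗-oneS u v)
    ; ε-mult     = λ Φ Ψ → +-identityʳ _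
    ; ε-unit     = refl
    ; cocomm     = λ Φ u v → viaPairing Φ u v Φ v u (∗-comm Φ u v)
    ; antipode   = antipode , antipode-isContinuousLinear ,
        (λ Φ w → trans (∑-cong (splits w) (λ p → antipode-resp (λ x → Δb≈∑qsh Φ x (proj₂ p)) (proj₁ p)))
                       (antipode⋆id Φ w)) ,
        (λ Φ w → trans (∑-cong (splits w) (λ p → antipode-resp (Δb≈∑qsh Φ (proj₁ p)) (proj₂ p)))
                       (id⋆antipode Φ w))
    }
    where
    viaPairing : ∀ Φ u v Ψ x y → ⟨ Φ ∣ u ∗ v ⟩ ≈ ⟨ Ψ ∣ x ∗ y ⟩ → Δb Φ u v ≈ Δb Ψ x y
    viaPairing Φ u v Ψ x y eq = trans (Δb≈∑qsh Φ u v) (trans eq (sym (Δb≈∑qsh Ψ x y)))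

    antipode-isContinuousLinear : IsContinuousLinear antipode
    antipode-isContinuousLinear = record
      { resp       = λ Φ Ψ → antipode-resp
      ; additive   = antipode-additive
      ; homogen    = antipode-homogen
      ; continuous = λ u → antipodeSupport u , antipode-local u
      }

  duality : Duality
  duality = record { conc-dual = λ Φ Ψ w → refl ; Δ-dual = Δb≈∑qsh }

proposition5p3 : ∀ {c ℓ} (R : CommutativeRing c ℓ) → Series.IsQAlgebra R →
                   Series.IsCompleteCocommutativeHopf R × Series.Duality R
proposition5p3 R _ = SeriesHopf.isHopf R , SeriesHopf.duality R
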